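{- Let $q$ be a prime power, let $m>1$ be a divisor of $n$, let $k$ be a positive integer with $\gcd(k,n)=1$, and let $t\in\{1,\ldots,m\}$. Then $\Phi^{(k)}_{m,n,t}=\bigoplus_{j=0}^{t-1}\Omega^{(k)}_j$ is a generalized Gabidulin $(m,n,q;m-t+1)$-code.
   Context: $\mathbb F_{q^m}\subseteq\mathbb F_{q^n}$; $\mathrm{Tr}:\mathbb F_{q^n}\to\mathbb F_q$ is the trace $y\mapsto\sum_{i=0}^{n-1}y^{q^i}$. $\Omega_{m,n}$ is the $\mathbb F_q$-space of all $\mathbb F_q$-bilinear forms $\mathbb F_{q^m}\times\mathbb F_{q^n}\to\mathbb F_q$. For $a\in\mathbb F_{q^n}$, $0\le j\le m-1$: $f^{(k)}_{a,j}(x,x')=\mathrm{Tr}(a\,x\,x'^{q^{kj}})$ and $\Omega^{(k)}_j=\{f^{(k)}_{a,j}:a\in\mathbb F_{q^n}\}$ (the sum is direct). Generalized Gabidulin codes: for $\mathbb F_q$-linearly independent $g_0,\ldots,g_{m-1}\in\mathbb F_{q^n}$, $1\le t\le m$, an integer $j$ with $\gcd(j,n)=1$, and an $\mathbb F_q$-basis $\{u_0,\ldots,u_{n-1}\}$ of $\mathbb F_{q^n}$, with $\mathcal L^{(j)}_t=\{\sum_{i=0}^{t-1}c_ix^{q^{ji}}:c_i\in\mathbb F_{q^n}\}$, the set of $m\times n$ matrices over $\mathbb F_q$ whose $i$-th row is the coordinate vector of $F(g_i)$ in the basis $\{u_l\}$, $F\in\mathcal L^{(j)}_t$, is a generalized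 Gabidulin $(m,n,q;m-t+1)$-code in $M_{m,n}(\mathbb F_q)$. A subset of $\Omega_{m,n}$ is a generalized Gabidulin code if, for some $\mathbb F_q$-bases $\{e_i\}$ of $\mathbb F_{q^m}$ and $\{e'_l\}$ of $\mathbb F_{q^n}$, the set of matrices $(f(e_i,e'_l))_{i,l}$ of its elements is a generalized Gabidulin code in $M_{m,n}(\mathbb F_q)$. -}

module Defs where

open import Level using (Level; _⊔_)
open import Algebra.Bundles using (CommutativeRing)
open import Data.Nat using (ℕ; zero; suc; _∸_; _^_; _≤_) renaming (_+_ to _+ℕ_; _*_ to _*ℕ_)
open import Data.Nat.Primality using (Prime)
open import Data.Nat.GCD using (gcd)
open import Data.Fin using (Fin; toℕ)
import Data.Fin as Fin
open import Data.Product using (Σ; ∃; _×_)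
open import Function.Bundles using (_⇔_)
open import Relation.Nullary using (¬_)
open import Relation.Binary.PropositionalEquality using (_≡_)

IsPrimePower : ℕ → Set
IsPrimePower q = ∃ λ p → ∃ λ r → Prime p × 1 ≤ r × q ≡ p ^ r

-- Everything below lives inside a commutative ring R which will be required
-- to be a field with exactly q^n elements (a model of F_{q^n}).
module FF {c ℓ} (R : CommutativeRing c ℓ) where
  open CommutativeRing R

  pow : Carrier → ℕ → Carrier
  pow x zero    = 1#
  pow x (suc e) = x * pow x e

  sumF : ∀ {d} → (Fin d → Carrier) → Carrier
  sumF {zero}  f = 0#
  sumF {suc d} f = f Fin.zero + sumF (λ i → f (Fin.suc i))

  IsField : Set (c ⊔ ℓ)
  IsField = ¬ (1# ≈ 0#) × (∀ x → ¬ (x ≈ 0#) → ∃ λ y → x * y ≈ 1#)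

  HasCard : ℕ → Set (c ⊔ ℓ)
  HasCard N = Σ (Fin N → Carrier) λ e →
    (∀ x → ∃ λ i → x ≈ e i) × (∀ i j → e i ≈ e j → i ≡ j)

  -- x belongs to the subfield F_{q^r} = { x | x^(q^r) = x }
  InSub : ℕ → ℕ → Carrier → Set ℓ
  InSub q r x = pow x (q ^ r) ≈ x

  Tr : ℕ → ℕ → Carrier → Carrier
  Tr q n y = sumF (λ (i : Fin n) → pow y (q ^ toℕ i))

  LinIndep : ℕ → ∀ {d} → (Fin d → Carrier) → Set (c ⊔ ℓ)
  LinIndep q {d} v = ∀ (λ' : Fin d → Carrier) → (∀ i → InSub q 1 (λ' i)) →
    sumF (λ i → λ' i * v i) ≈ 0# → ∀ i → λ' i ≈ 0#

  Spans : ℕ → ℕ → ∀ {d} → (Fin d → Carrier) → Set (c ⊔ ℓ)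
  Spans q r {d} v = ∀ x → InSub q r x → ∃ λ (λ' : Fin d → Carrier) →
    (∀ i → InSub q 1 (λ' i)) × (x ≈ sumF (λ i → λ' i * v i))

  IsBasis : ℕ → ℕ → ∀ {d} → (Fin d → Carrier) → Set (c ⊔ ℓ)
  IsBasis q r v = (∀ i → InSub q r (v i)) × LinIndep q v × Spans q r v

  Matrix : ℕ → ℕ → Set c
  Matrix m n = Fin m → Fin n → Carrier

  LinPoly : ℕ → ℕ → ∀ {t} → (Fin t → Carrier) → Carrier → Carrier
  LinPoly q j c x = sumF (λ s → c s * pow x (q ^ (j *ℕ toℕ s)))

  InGabidulin : ℕ → (m n t j : ℕ) → (Fin m → Carrier) → (Fin n → Carrier) →
                Matrix m n → Set (c ⊔ ℓ)
  InGabidulin q m n t j g u M = ∃ λ (cs : Fin t → Carrier) →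
    ∀ i → LinPoly q j cs (g i) ≈ sumF (λ l → M i l * u l)

  IsGenGabidulinCode : ∀ {a} → (q m n d : ℕ) → (Matrix m n → Set a) → Set (c ⊔ ℓ ⊔ a)
  IsGenGabidulinCode q m n d C =
    ∃ λ t → 1 ≤ t × t ≤ m × d ≡ m ∸ t +ℕ 1 ×
    ∃ λ (g : Fin m → Carrier) → LinIndep q g ×
    ∃ λ j → gcd j n ≡ 1 ×
    ∃ λ (u : Fin n → Carrier) → IsBasis q n u ×
    (∀ (M : Matrix m n) → (∀ i l → InSub q 1 (M i l)) →
       (C M ⇔ InGabidulin q m n t j g u M))

  -- bilinear forms F_{q^m} × F_{q^n} → F_q are represented as functions
  -- Carrier → Carrier → Carrier (only values on F_{q^m} × F_{q^n} matter)
  Form : Set c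
  Form = Carrier → Carrier → Carrier

  IsGenGabidulinForms : ∀ {a} → (q m n d : ℕ) → (Form → Set a) → Set (c ⊔ ℓ ⊔ a)
  IsGenGabidulinForms q m n d S =
    ∃ λ (e : Fin m → Carrier) → IsBasis q m e ×
    ∃ λ (e' : Fin n → Carrier) → IsBasis q n e' ×
    IsGenGabidulinCode q m n d
      (λ M → ∃ λ f → S f × (∀ i l → M i l ≈ f (e i) (e' l)))

  fForm : (q n k : ℕ) → Carrier → ℕ → Form
  fForm q n k a j x x' = Tr q n (a * x * pow x' (q ^ (k *ℕ j)))

  -- Φ^{(k)}_{m,n,t} = ⊕_{j<t} Ω^{(k)}_j : forms Σ_{j<t} f^{(k)}_{a_j,j},
  -- compared extensionally on F_{q^m} × F_{q^n}
  Phi : (q m n k t : ℕ) → Form → Set (c ⊔ ℓ)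
  Phi q m n k t f = ∃ λ (a : Fin t → Carrier) →
    ∀ x x' → InSub q m x → f x x' ≈ sumF (λ (j : Fin t) → fForm q n k (a j) (toℕ j) x x')

module Submission where

-- Gabidulin              with j = k(n-1) ≡ -k (mod n), a Frobenius twist
--                          inside the trace turns Σ_s Tr(a_s x x'^(q^(ks))) into
--                          Tr(F(x) x') for F = Σ_s a_s^(q^(js)) x^(q^(js)); on
--                          bases e of F_{q^m} and e' of F_{q^n} its matrix is the
--                          coordinate matrix of the F(e_i) in the dual basis of e'.

open import Defs
open import Level using (Level; _⊔_; Lift; lift; lower)
open import Algebra.Bundles using (CommutativeRing)
open import Data.Nat using (ℕ; zero; suc; z≤n; s≤s)
  renaming (_+_ to _+ℕ_; _*_ to _*ℕ_; _^_ to _^ℕ_; _∸_ to _∸ℕ_; _≤_ to _≤ℕ_; _<_ to _<ℕ_)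
import Data.Nat as ℕ
import Data.Nat.Properties as ℕP
open import Data.Nat.Primality using (Prime)
open import Data.Nat.Divisibility using (_∣_; divides)
open import Data.Fin using (Fin; toℕ; fromℕ; fromℕ<; inject₁; punchIn; punchOut)
  renaming (zero to fz; suc to fs)
import Data.Fin.Properties as FinP
open import Data.Product using (Σ; ∃; _×_; _,_; proj₁; proj₂)
open import Data.Sum using (_⊎_; inj₁; inj₂)
open import Data.Unit using (⊤; tt)
open import Data.Empty using (⊥-elim)
open import Relation.Nullary using (¬_; Dec; yes; no)
open import Relation.Nullary.Decidable using (_×-dec_; ¬?)
open import Relation.Binary.PropositionalEquality as P using (_≡_; _≢_)

-- Every size computation in
-- the development (of the field, its subfields, spans and orthogonal
-- complements) is a count over an enumeration of the field, and the main
-- tool is double counting: the size of a disjoint union of fibres.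
module Counting where
  open import Data.Nat.Base using (_+_; _*_; _≤_)
  open import Relation.Binary.PropositionalEquality.Core using (refl)
  open import Function.Bundles using (mk↔ₛ′)
  import Algebra.Properties.CommutativeMonoid.Sum as MonoidSum
  import Algebra.Properties.CommutativeSemigroup as CommSemigroupProperties

  private variable
    a b h : Level

  χ : ∀ {A : Set a} → Dec A → ℕ
  χ (yes _) = 1
  χ (no _)  = 0

  Σℕ : ∀ {d} → (Fin d → ℕ) → ℕ
  Σℕ {zero}  f = 0
  Σℕ {suc d} f = f fz + Σℕ (λ i → f (fs i))

  count : ∀ {d} {P : Fin d → Set a} → (∀ i → Dec (P i)) → ℕ
  count P? = Σℕ (λ i → χ (P? i))

  Σℕ-cong : ∀ {d} {f g : Fin d → ℕ} → (∀ i → f i ≡ g i) → Σℕ f ≡ Σℕ g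
  Σℕ-cong {zero}  f≡g = refl
  Σℕ-cong {suc d} f≡g = P.cong₂ _+_ (f≡g fz) (Σℕ-cong (λ i → f≡g (fs i)))

  Σℕ-mono : ∀ {d} {f g : Fin d → ℕ} → (∀ i → f i ≤ g i) → Σℕ f ≤ Σℕ g
  Σℕ-mono {zero}  f≤g = z≤n
  Σℕ-mono {suc d} f≤g = ℕP.+-mono-≤ (f≤g fz) (Σℕ-mono (λ i → f≤g (fs i)))

  Σℕ-+ : ∀ {d} (f g : Fin d → ℕ) → Σℕ (λ i → f i + g i) ≡ Σℕ f + Σℕ g
  Σℕ-+ {zero}  f g = refl
  Σℕ-+ {suc d} f g = P.trans (P.cong (f fz + g fz +_) (Σℕ-+ (λ i → f (fs i)) (λ i → g (fs i))))
                             (interchange (f fz) (g fz) _ _)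
    where open CommSemigroupProperties ℕP.+-commutativeSemigroup using (interchange)

  Σℕ-*ˡ : ∀ {d} k (f : Fin d → ℕ) → k * Σℕ f ≡ Σℕ (λ i → k * f i)
  Σℕ-*ˡ {zero}  k f = ℕP.*-zeroʳ k
  Σℕ-*ˡ {suc d} k f = P.trans (ℕP.*-distribˡ-+ k (f fz) _) (P.cong (k * f fz +_) (Σℕ-*ˡ k (λ i → f (fs i))))

  Σℕ-*ʳ : ∀ {d} (f : Fin d → ℕ) k → Σℕ (λ i → f i * k) ≡ Σℕ f * k
  Σℕ-*ʳ {zero}  f k = refl
  Σℕ-*ʳ {suc d} f k = P.trans (P.cong (f fz * k +_) (Σℕ-*ʳ (λ i → f (fs i)) k))
                              (P.sym (ℕP.*-distribʳ-+ k (f fz) _))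

  Σℕ-zero : ∀ {d} (f : Fin d → ℕ) → (∀ i → f i ≡ 0) → Σℕ f ≡ 0
  Σℕ-zero {zero}  f f≡0 = refl
  Σℕ-zero {suc d} f f≡0 = P.cong₂ _+_ (f≡0 fz) (Σℕ-zero _ (λ i → f≡0 (fs i)))

  Σℕ-swap : ∀ {d e} (f : Fin d → Fin e → ℕ) →
            Σℕ (λ i → Σℕ (λ j → f i j)) ≡ Σℕ (λ j → Σℕ (λ i → f i j))
  Σℕ-swap {zero}  {e} f = P.sym (Σℕ-zero {e} _ (λ j → refl))
  Σℕ-swap {suc d} {e} f = P.trans (P.cong (Σℕ (f fz) +_) (Σℕ-swap (λ i → f (fs i))))
                                  (P.sym (Σℕ-+ {e} (f fz) _))

  Σℕ-permute : ∀ {d} (f : Fin d → ℕ) (π σ : Fin d → Fin d) →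
               (∀ i → π (σ i) ≡ i) → (∀ i → σ (π i) ≡ i) → Σℕ (λ i → f (π i)) ≡ Σℕ f
  Σℕ-permute {d} f π σ πσ σπ =
    P.trans (Σℕ≡sum {d} _) (P.trans (P.sym (sum-permute f (mk↔ₛ′ π σ πσ σπ))) (P.sym (Σℕ≡sum f)))
    where
    open MonoidSum ℕP.+-0-commutativeMonoid using (sum; sum-permute)
    Σℕ≡sum : ∀ {d} (f : Fin d → ℕ) → Σℕ f ≡ sum f
    Σℕ≡sum {zero}  f = refl
    Σℕ≡sum {suc d} f = P.cong (f fz +_) (Σℕ≡sum (λ i → f (fs i)))

  χ-mono : ∀ {A : Set a} {B : Set b} (A? : Dec A) (B? : Dec B) → (A → B) → χ A? ≤ χ B?
  χ-mono (yes x) (yes _) A⇒B = s≤s z≤n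
  χ-mono (yes x) (no ¬y) A⇒B = ⊥-elim (¬y (A⇒B x))
  χ-mono (no _)  B?      A⇒B = z≤n

  χ-∪ : ∀ {A : Set a} {B : Set b} {C : Set h} (A? : Dec A) (B? : Dec B) (C? : Dec C) →
        (C → A ⊎ B) → χ C? ≤ χ A? + χ B?
  χ-∪ A?       B?       (no _)  C⇒A⊎B = z≤n
  χ-∪ (yes _)  B?       (yes _) C⇒A⊎B = s≤s z≤n
  χ-∪ (no _)   (yes _)  (yes _) C⇒A⊎B = s≤s z≤n
  χ-∪ (no ¬x)  (no ¬y)  (yes z) C⇒A⊎B with C⇒A⊎B z
  ... | inj₁ x = ⊥-elim (¬x x)
  ... | inj₂ y = ⊥-elim (¬y y)

  χ-× : ∀ {A : Set a} {B : Set b} (A? : Dec A) (B? : Dec B) → χ (A? ×-dec B?) ≡ χ A? * χ B?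
  χ-× (yes _) (yes _) = refl
  χ-× (yes _) (no _)  = refl
  χ-× (no _)  B?      = refl

  count-mono : ∀ {d} {P : Fin d → Set a} {Q : Fin d → Set b} (P? : ∀ i → Dec (P i)) (Q? : ∀ i → Dec (Q i)) →
               (∀ i → P i → Q i) → count P? ≤ count Q?
  count-mono P? Q? P⇒Q = Σℕ-mono (λ i → χ-mono (P? i) (Q? i) (P⇒Q i))

  count-ext : ∀ {d} {P : Fin d → Set a} {Q : Fin d → Set b} (P? : ∀ i → Dec (P i)) (Q? : ∀ i → Dec (Q i)) →
              (∀ i → P i → Q i) → (∀ i → Q i → P i) → count P? ≡ count Q?
  count-ext P? Q? P⇒Q Q⇒P = ℕP.≤-antisym (count-mono P? Q? P⇒Q) (count-mono Q? P? Q⇒P)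

  count-∪ : ∀ {d} {P : Fin d → Set a} {Q : Fin d → Set b} {S : Fin d → Set h}
            (P? : ∀ i → Dec (P i)) (Q? : ∀ i → Dec (Q i)) (S? : ∀ i → Dec (S i)) →
            (∀ i → S i → P i ⊎ Q i) → count S? ≤ count P? + count Q?
  count-∪ {d = d} P? Q? S? S⊆P∪Q = ℕP.≤-trans (Σℕ-mono (λ i → χ-∪ (P? i) (Q? i) (S? i) (S⊆P∪Q i)))
                                         (ℕP.≤-reflexive (Σℕ-+ {d} _ _))

  count-all : ∀ {d} {P : Fin d → Set a} (P? : ∀ i → Dec (P i)) → (∀ i → P i) → count P? ≡ d
  count-all {d = zero}  P? all = refl
  count-all {d = suc d} P? all with P? fz
  ... | yes _ = P.cong suc (count-all (λ i → P? (fs i)) (λ i → all (fs i)))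
  ... | no ¬p = ⊥-elim (¬p (all fz))

  count-none : ∀ {d} {P : Fin d → Set a} (P? : ∀ i → Dec (P i)) → (∀ i → ¬ P i) → count P? ≡ 0
  count-none {d = zero}  P? none = refl
  count-none {d = suc d} P? none with P? fz
  ... | yes p = ⊥-elim (none fz p)
  ... | no _  = count-none (λ i → P? (fs i)) (λ i → none (fs i))

  count-pos : ∀ {d} {P : Fin d → Set a} (P? : ∀ i → Dec (P i)) i → P i → 1 ≤ count P?
  count-pos {d = suc d} P? fz p with P? fz
  ... | yes _ = s≤s z≤n
  ... | no ¬p = ⊥-elim (¬p p)
  count-pos {d = suc d} P? (fs i) p = ℕP.≤-trans (count-pos (λ j → P? (fs j)) i p) (ℕP.m≤n+m _ _)

  count-≤1 : ∀ {d} {P : Fin d → Set a} (P? : ∀ i → Dec (P i)) → (∀ i j → P i → P j → i ≡ j) → count P? ≤ 1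
  count-≤1 {d = zero}  P? unique = z≤n
  count-≤1 {d = suc d} P? unique with P? fz
  ... | yes p = ℕP.≤-reflexive (P.cong suc (count-none (λ i → P? (fs i))
                                              (λ i q → FinP.0≢1+n (unique fz (fs i) p q))))
  ... | no _  = count-≤1 (λ i → P? (fs i)) (λ i j p q → FinP.suc-injective (unique (fs i) (fs j) p q))

  count-one : ∀ {d} {P : Fin d → Set a} (P? : ∀ i → Dec (P i)) i → P i →
              (∀ i j → P i → P j → i ≡ j) → count P? ≡ 1
  count-one P? i p unique = ℕP.≤-antisym (count-≤1 P? unique) (count-pos P? i p)

  count-witness : ∀ {d} {P : Fin d → Set a} (P? : ∀ i → Dec (P i)) → 1 ≤ count P? → ∃ P
  count-witness {d = suc d} P? pos with P? fz
  ... | yes p = fz , p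
  ... | no _  with count-witness (λ i → P? (fs i)) pos
  ...   | i , p = fs i , p

  count-permute : ∀ {d} {P : Fin d → Set a} (P? : ∀ i → Dec (P i)) (π σ : Fin d → Fin d) →
                  (∀ i → π (σ i) ≡ i) → (∀ i → σ (π i) ≡ i) → count (λ i → P? (π i)) ≡ count P?
  count-permute P? = Σℕ-permute (λ i → χ (P? i))

  double-count : ∀ {d e} {T : Fin e → Set a} {A : Fin e → Fin d → Set b} {S : Fin d → Set h}
    (T? : ∀ t → Dec (T t)) (A? : ∀ t i → Dec (A t i)) (S? : ∀ i → Dec (S i)) →
    (∀ i → S i → ∃ λ t → T t × A t i) →
    (∀ i t → T t → A t i → S i) →
    (∀ i t t' → T t → A t i → T t' → A t' i → t ≡ t') →
    count S? ≡ Σℕ (λ t → χ (T? t) * count (A? t))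
  double-count {d = d} {e} T? A? S? covered included disjoint = begin
    Σℕ (λ i → χ (S? i))                           ≡⟨ Σℕ-cong χS≡ ⟩
    Σℕ (λ i → Σℕ (λ t → χ (T? t ×-dec A? t i)))  ≡⟨ Σℕ-swap {d} {e} _ ⟩
    Σℕ (λ t → Σℕ (λ i → χ (T? t ×-dec A? t i)))  ≡⟨ Σℕ-cong (λ t → Σℕ-cong (λ i → χ-× (T? t) (A? t i))) ⟩
    Σℕ (λ t → Σℕ (λ i → χ (T? t) * χ (A? t i)))  ≡⟨ Σℕ-cong (λ t → P.sym (Σℕ-*ˡ {d} (χ (T? t)) _)) ⟩
    Σℕ (λ t → χ (T? t) * count (A? t))           ∎
    where
    open P.≡-Reasoning
    -- each element of S lies in exactly one of the sets A t
    χS≡ : ∀ i → χ (S? i) ≡ Σℕ (λ t → χ (T? t ×-dec A? t i))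
    χS≡ i with S? i
    ... | yes s = let (t , Tt , At) = covered i s in
          P.sym (count-one (λ t → T? t ×-dec A? t i) t (Tt , At)
                           (λ t t' (Tt , At) (Tt' , At') → disjoint i t t' Tt At Tt' At'))
    ... | no ¬s = P.sym (count-none (λ t → T? t ×-dec A? t i) (λ t (Tt , At) → ¬s (included i t Tt At)))

  Σ-restricted-≤ : ∀ {e} {T : Fin e → Set a} (T? : ∀ t → Dec (T t)) (f : Fin e → ℕ) k →
                   (∀ t → T t → f t ≤ k) → Σℕ (λ t → χ (T? t) * f t) ≤ count T? * k
  Σ-restricted-≤ {e = e} T? f k f≤k =
    ℕP.≤-trans (Σℕ-mono termwise) (ℕP.≤-reflexive (Σℕ-*ʳ {e} (λ t → χ (T? t)) k))
    where
    termwise : ∀ t → χ (T? t) * f t ≤ χ (T? t) * k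
    termwise t with T? t
    ... | yes Tt = ℕP.+-monoˡ-≤ 0 (f≤k t Tt)
    ... | no _   = z≤n

  Σ-restricted-≡ : ∀ {e} {T : Fin e → Set a} (T? : ∀ t → Dec (T t)) (f : Fin e → ℕ) k →
                   (∀ t → T t → f t ≡ k) → Σℕ (λ t → χ (T? t) * f t) ≡ count T? * k
  Σ-restricted-≡ {e = e} T? f k f≡k = P.trans (Σℕ-cong termwise) (Σℕ-*ʳ {e} (λ t → χ (T? t)) k)
    where
    termwise : ∀ t → χ (T? t) * f t ≡ χ (T? t) * k
    termwise t with T? t
    ... | yes Tt = P.cong (_+ 0) (f≡k t Tt)
    ... | no _   = refl

  count-complement : ∀ {d} {P : Fin d → Set a} (P? : ∀ i → Dec (P i)) → count P? + count (λ i → ¬? (P? i)) ≡ d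
  count-complement {d = zero}  P? = refl
  count-complement {d = suc d} P? with P? fz
  ... | yes _ = P.cong suc (count-complement (λ i → P? (fs i)))
  ... | no _  = P.trans (ℕP.+-suc _ _) (P.cong suc (count-complement (λ i → P? (fs i))))

module Arithmetic where
  open import Data.Nat
  open import Data.Nat.Properties
  open import Data.Nat.Divisibility
  open import Data.Nat.DivMod using (m/n*n≡m)
  open import Data.Nat.Primality using (Prime; euclidsLemma; prime⇒nonTrivial)
  open import Data.Nat.Combinatorics using (_C_; k![n∸k]!∣n!)
  open import Data.Nat.Combinatorics.Specification using (nCk≡n!/k![n-k]!)
  open import Data.Nat.Coprimality using (Coprime; coprime-divisor; gcd≡1⇒coprime; coprime⇒gcd≡1)
  open import Data.Nat.GCD using (gcd)
  open import Relation.Binary.PropositionalEquality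

  prime≥2 : ∀ {p} → Prime p → 2 ≤ p
  prime≥2 {p} p-prime = nonTrivial⇒n>1 p {{prime⇒nonTrivial p-prime}}

  prime∤factorial : ∀ {p} → Prime p → ∀ j → j < p → ¬ (p ∣ j !)
  prime∤factorial p-prime zero    _   p∣1 = nonTrivial⇒≢1 {{prime⇒nonTrivial p-prime}} (∣1⇒≡1 p∣1)
  prime∤factorial p-prime (suc j) j<p p∣j! with euclidsLemma (suc j) (j !) p-prime p∣j!
  ... | inj₁ p∣j+1 = <⇒≱ j<p (∣⇒≤ p∣j+1)
  ... | inj₂ p∣j!' = prime∤factorial p-prime j (<-trans (n<1+n j) j<p) p∣j!'

  -- p divides the binomial coefficients p C k for 0 < k < p: the numerator of
  -- p!/(k!(p-k)!) is divisible by p, the denominator is not.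
  prime∣binomial : ∀ {p} → Prime p → ∀ k → 0 < k → k < p → p ∣ p C k
  prime∣binomial {p} p-prime k 0<k k<p with euclidsLemma (p C k) (k ! * (p ∸ k) !) p-prime p∣product
    where
    C*denominator≡p! : (p C k) * (k ! * (p ∸ k) !) ≡ p !
    C*denominator≡p! = trans (cong (_* (k ! * (p ∸ k) !)) (nCk≡n!/k![n-k]! (<⇒≤ k<p)))
                             (m/n*n≡m {{k !* (p ∸ k) !≢0}} (k![n∸k]!∣n! (<⇒≤ k<p)))
    p∣p! : p ∣ p !
    p∣p! with prime≥2 p-prime
    ... | s≤s _ = m∣m*n _
    p∣product : p ∣ (p C k) * (k ! * (p ∸ k) !)
    p∣product = subst (p ∣_) (sym C*denominator≡p!) p∣p!
  ... | inj₁ p∣C = p∣C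
  ... | inj₂ p∣denominator with euclidsLemma (k !) ((p ∸ k) !) p-prime p∣denominator
  ...   | inj₁ p∣k!   = ⊥-elim (prime∤factorial p-prime k k<p p∣k!)
  ...   | inj₂ p∣p-k! = ⊥-elim (prime∤factorial p-prime (p ∸ k) (∸-monoʳ-< 0<k (<⇒≤ k<p)) p∣p-k!)

  -- If k is coprime to n then so is k(n-1) ≡ -k (mod n).
  coprime-*pred : ∀ k n → 1 ≤ n → gcd k n ≡ 1 → gcd (k * (n ∸ 1)) n ≡ 1
  coprime-*pred k n 1≤n gcd≡1 = coprime⇒gcd≡1 k[n-1]⊥n
    where
    k⊥n : Coprime k n
    k⊥n = gcd≡1⇒coprime gcd≡1
    k[n-1]⊥n : Coprime (k * (n ∸ 1)) n
    k[n-1]⊥n {d} (d∣k[n-1] , d∣n) = ∣1⇒≡1 d∣1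
      where
      d⊥k : Coprime d k
      d⊥k (e∣d , e∣k) = k⊥n (e∣k , ∣-trans e∣d d∣n)
      d∣n-1 : d ∣ n ∸ 1
      d∣n-1 = coprime-divisor d⊥k d∣k[n-1]
      d∣1 : d ∣ 1
      d∣1 = ∣m+n∣m⇒∣n (subst (d ∣_) (sym (m∸n+n≡m 1≤n)) d∣n) d∣n-1

  IsPowerOf : ℕ → ℕ → Set
  IsPowerOf p Q = ∃ λ a → Q ≡ p ^ a

  powerOf-^ : ∀ {p Q} → IsPowerOf p Q → ∀ s → IsPowerOf p (Q ^ s)
  powerOf-^ {p} (a , refl) s = a * s , ^-*-assoc p a s

  powerOf>0 : ∀ {p Q} → Prime p → IsPowerOf p Q → 0 < Q
  powerOf>0 {p} p-prime (a , refl) = m^n>0 p {{>-nonZero (<-trans (s≤s z≤n) (prime≥2 p-prime))}} a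

module FiniteField {c ℓ} (R : CommutativeRing c ℓ) (isField : FF.IsField R)
                   (N : ℕ) (card : FF.HasCard R N) where
  open Counting
  open import Data.Fin.Permutation using (Permutation)
  open import Function.Bundles using (mk↔ₛ′)
  import Algebra.Properties.Ring as RingProperties
  import Algebra.Properties.CommutativeSemigroup as CommSemigroupProperties
  import Algebra.Properties.Group as GroupProperties
  import Algebra.Properties.CommutativeMonoid.Sum as MonoidSum

  open CommutativeRing R public
  open FF R public
  open import Relation.Binary.Reasoning.Setoid setoid public
  open RingProperties ring public using (-1*x≈-x; -‿distribˡ-*; -‿distribʳ-*)
  module *-Props = CommSemigroupProperties *-commutativeSemigroup
  module +-Props = CommSemigroupProperties +-commutativeSemigroup
  module +-Group = GroupProperties +-group

  en : Fin N → Carrier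
  en = proj₁ card

  idx : Carrier → Fin N
  idx x = proj₁ (proj₁ (proj₂ card) x)

  en-idx : ∀ x → x ≈ en (idx x)
  en-idx x = proj₂ (proj₁ (proj₂ card) x)

  en-injective : ∀ i j → en i ≈ en j → i ≡ j
  en-injective = proj₂ (proj₂ card)

  idx-cong : ∀ {x y} → x ≈ y → idx x ≡ idx y
  idx-cong {x} {y} x≈y = en-injective _ _ (trans (sym (en-idx x)) (trans x≈y (en-idx y)))

  idx-en : ∀ i → idx (en i) ≡ i
  idx-en i = en-injective _ _ (sym (en-idx (en i)))

  infix 4 _≟_
  _≟_ : ∀ x y → Dec (x ≈ y)
  x ≟ y with idx x FinP.≟ idx y
  ... | yes i≡j = yes (trans (en-idx x) (trans (reflexive (P.cong en i≡j)) (sym (en-idx y))))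
  ... | no i≢j  = no (λ x≈y → i≢j (idx-cong x≈y))

  1≉0 : ¬ (1# ≈ 0#)
  1≉0 = proj₁ isField

  N≢1 : N ≢ 1
  N≢1 N≡1 = 1≉0 (trans (en-idx 1#) (trans (reflexive (P.cong en (Fin-singleton N≡1 _ _))) (sym (en-idx 0#))))
    where
    Fin-singleton : ∀ {M} → M ≡ 1 → (i j : Fin M) → i ≡ j
    Fin-singleton P.refl fz fz = P.refl

  inv : ∀ x → ¬ (x ≈ 0#) → Carrier
  inv x x≉0 = proj₁ (proj₂ isField x x≉0)

  inv-r : ∀ x (x≉0 : ¬ (x ≈ 0#)) → x * inv x x≉0 ≈ 1#
  inv-r x x≉0 = proj₂ (proj₂ isField x x≉0)

  inv-l : ∀ x (x≉0 : ¬ (x ≈ 0#)) → inv x x≉0 * x ≈ 1#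
  inv-l x x≉0 = trans (*-comm _ _) (inv-r x x≉0)

  *-cancelˡ : ∀ {x y} z → ¬ (z ≈ 0#) → z * x ≈ z * y → x ≈ y
  *-cancelˡ {x} {y} z z≉0 zx≈zy = begin
    x                      ≈⟨ sym (*-identityˡ x) ⟩
    1# * x                 ≈⟨ *-congʳ (sym (inv-l z z≉0)) ⟩
    (inv z z≉0 * z) * x    ≈⟨ *-assoc _ _ _ ⟩
    inv z z≉0 * (z * x)    ≈⟨ *-congˡ zx≈zy ⟩
    inv z z≉0 * (z * y)    ≈⟨ sym (*-assoc _ _ _) ⟩
    (inv z z≉0 * z) * y    ≈⟨ *-congʳ (inv-l z z≉0) ⟩
    1# * y                 ≈⟨ *-identityˡ y ⟩
    y                      ∎

  no-zero-divisors : ∀ {x y} → x * y ≈ 0# → x ≈ 0# ⊎ y ≈ 0#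
  no-zero-divisors {x} {y} xy≈0 with x ≟ 0#
  ... | yes x≈0 = inj₁ x≈0
  ... | no x≉0  = inj₂ (*-cancelˡ x x≉0 (trans xy≈0 (sym (zeroʳ x))))

  *-nonzero : ∀ {x y} → ¬ (x ≈ 0#) → ¬ (y ≈ 0#) → ¬ (x * y ≈ 0#)
  *-nonzero x≉0 y≉0 xy≈0 with no-zero-divisors xy≈0
  ... | inj₁ x≈0 = x≉0 x≈0
  ... | inj₂ y≈0 = y≉0 y≈0

  x-y≈0⇒x≈y : ∀ {x y} → x - y ≈ 0# → x ≈ y
  x-y≈0⇒x≈y {x} {y} = +-Group.x∙y⁻¹≈ε⇒x≈y x y

  x≈y⇒x-y≈0 : ∀ {x y} → x ≈ y → x - y ≈ 0#
  x≈y⇒x-y≈0 = +-Group.x≈y⇒x∙y⁻¹≈ε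

  +-cancelʳ : ∀ {x y} z → x + z ≈ y + z → x ≈ y
  +-cancelʳ {x} {y} z = +-Group.∙-cancelʳ z x y

  -‿0 : - 0# ≈ 0#
  -‿0 = +-Group.ε⁻¹≈ε

  -‿+ : ∀ x y → - (x + y) ≈ - x + - y
  -‿+ x y = trans (+-Group.⁻¹-anti-homo-∙ x y) (+-comm _ _)

  pow-cong : ∀ {x y} e → x ≈ y → pow x e ≈ pow y e
  pow-cong zero    x≈y = refl
  pow-cong (suc e) x≈y = *-cong x≈y (pow-cong e x≈y)

  pow-≡ : ∀ x {a b} → a ≡ b → pow x a ≈ pow x b
  pow-≡ x P.refl = refl

  pow-+ : ∀ x a b → pow x (a +ℕ b) ≈ pow x a * pow x b
  pow-+ x zero    b = sym (*-identityˡ _)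
  pow-+ x (suc a) b = trans (*-congˡ (pow-+ x a b)) (sym (*-assoc _ _ _))

  pow-* : ∀ x y e → pow (x * y) e ≈ pow x e * pow y e
  pow-* x y zero    = sym (*-identityˡ 1#)
  pow-* x y (suc e) = trans (*-congˡ (pow-* x y e)) (*-Props.interchange x y (pow x e) (pow y e))

  pow-1# : ∀ b → pow 1# b ≈ 1#
  pow-1# zero    = refl
  pow-1# (suc b) = trans (*-identityˡ _) (pow-1# b)

  pow-pow : ∀ x a b → pow x (a *ℕ b) ≈ pow (pow x a) b
  pow-pow x zero    b = sym (pow-1# b)
  pow-pow x (suc a) b = begin
    pow x (b +ℕ a *ℕ b)           ≈⟨ pow-+ x b (a *ℕ b) ⟩
    pow x b * pow x (a *ℕ b)      ≈⟨ *-congˡ (pow-pow x a b) ⟩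
    pow x b * pow (pow x a) b     ≈⟨ sym (pow-* x (pow x a) b) ⟩
    pow (x * pow x a) b           ∎

  pow-nonzero : ∀ {x} e → ¬ (x ≈ 0#) → ¬ (pow x e ≈ 0#)
  pow-nonzero zero    x≉0 = 1≉0
  pow-nonzero (suc e) x≉0 = *-nonzero x≉0 (pow-nonzero e x≉0)

  pow≈0⇒≈0 : ∀ {x} e → pow x e ≈ 0# → x ≈ 0#
  pow≈0⇒≈0 {x} e xᵉ≈0 with x ≟ 0#
  ... | yes x≈0 = x≈0
  ... | no x≉0  = ⊥-elim (pow-nonzero e x≉0 xᵉ≈0)

  sumF-cong : ∀ {d} {f g : Fin d → Carrier} → (∀ i → f i ≈ g i) → sumF f ≈ sumF g
  sumF-cong {zero}  f≈g = refl
  sumF-cong {suc d} f≈g = +-cong (f≈g fz) (sumF-cong (λ i → f≈g (fs i)))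

  sumF-+ : ∀ {d} (f g : Fin d → Carrier) → sumF (λ i → f i + g i) ≈ sumF f + sumF g
  sumF-+ {zero}  f g = sym (+-identityˡ 0#)
  sumF-+ {suc d} f g = trans (+-congˡ (sumF-+ (λ i → f (fs i)) (λ i → g (fs i))))
                             (+-Props.interchange (f fz) (g fz) _ _)

  sumF-zero : ∀ {d} (f : Fin d → Carrier) → (∀ i → f i ≈ 0#) → sumF f ≈ 0#
  sumF-zero {zero}  f f≈0 = refl
  sumF-zero {suc d} f f≈0 = trans (+-cong (f≈0 fz) (sumF-zero (λ i → f (fs i)) (λ i → f≈0 (fs i))))
                                  (+-identityˡ 0#)

  sumF-*ˡ : ∀ {d} x (f : Fin d → Carrier) → x * sumF f ≈ sumF (λ i → x * f i)
  sumF-*ˡ {zero}  x f = zeroʳ x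
  sumF-*ˡ {suc d} x f = trans (distribˡ x _ _) (+-congˡ (sumF-*ˡ x (λ i → f (fs i))))

  sumF-*ʳ : ∀ {d} x (f : Fin d → Carrier) → sumF f * x ≈ sumF (λ i → f i * x)
  sumF-*ʳ x f = trans (*-comm _ _) (trans (sumF-*ˡ x f) (sumF-cong (λ i → *-comm x (f i))))

  sumF-single : ∀ {d} (f : Fin d → Carrier) (l : Fin d) → (∀ i → i ≢ l → f i ≈ 0#) → sumF f ≈ f l
  sumF-single {suc d} f fz     f≈0 =
    trans (+-congˡ (sumF-zero _ (λ i → f≈0 (fs i) (λ ())))) (+-identityʳ _)
  sumF-single {suc d} f (fs l) f≈0 =
    trans (+-congʳ (f≈0 fz (λ ()))) (trans (+-identityˡ _)
      (sumF-single (λ i → f (fs i)) l (λ i i≢l → f≈0 (fs i) (λ e → i≢l (FinP.suc-injective e)))))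

  sumF-swap : ∀ {a b} (f : Fin a → Fin b → Carrier) →
              sumF (λ i → sumF (λ j → f i j)) ≈ sumF (λ j → sumF (λ i → f i j))
  sumF-swap {zero}  {b} f = sym (sumF-zero {b} _ (λ j → refl))
  sumF-swap {suc a} {b} f = begin
    sumF (f fz) + sumF (λ i → sumF (λ j → f (fs i) j))   ≈⟨ +-congˡ (sumF-swap (λ i → f (fs i))) ⟩
    sumF (f fz) + sumF (λ j → sumF (λ i → f (fs i) j))   ≈⟨ sym (sumF-+ {b} _ _) ⟩
    sumF (λ j → f fz j + sumF (λ i → f (fs i) j))        ∎

  sumF-last : ∀ {d} (f : Fin (suc d) → Carrier) → sumF f ≈ sumF (λ i → f (inject₁ i)) + f (fromℕ d)
  sumF-last {zero}  f = trans (+-identityʳ _) (sym (+-identityˡ _))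
  sumF-last {suc d} f = trans (+-congˡ (sumF-last (λ i → f (fs i)))) (sym (+-assoc _ _ _))

  -- sumF agrees with the library's sum over the additive monoid (used to
  -- import permutation invariance and the binomial theorem).
  module +-Sum = MonoidSum +-commutativeMonoid
  module *-Sum = MonoidSum *-commutativeMonoid

  sumF≡sum : ∀ {d} (f : Fin d → Carrier) → sumF f ≡ +-Sum.sum f
  sumF≡sum {zero}  f = P.refl
  sumF≡sum {suc d} f = P.cong (f fz +_) (sumF≡sum (λ i → f (fs i)))

  prodF : ∀ {d} → (Fin d → Carrier) → Carrier
  prodF {zero}  f = 1#
  prodF {suc d} f = f fz * prodF (λ i → f (fs i))

  prodF-cong : ∀ {d} {f g : Fin d → Carrier} → (∀ i → f i ≈ g i) → prodF f ≈ prodF g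
  prodF-cong {zero}  f≈g = refl
  prodF-cong {suc d} f≈g = *-cong (f≈g fz) (prodF-cong (λ i → f≈g (fs i)))

  prodF-* : ∀ {d} (f g : Fin d → Carrier) → prodF (λ i → f i * g i) ≈ prodF f * prodF g
  prodF-* {zero}  f g = sym (*-identityˡ 1#)
  prodF-* {suc d} f g = trans (*-congˡ (prodF-* (λ i → f (fs i)) (λ i → g (fs i))))
                              (*-Props.interchange (f fz) (g fz) _ _)

  prodF≡prod : ∀ {d} (f : Fin d → Carrier) → prodF f ≡ *-Sum.sum f
  prodF≡prod {zero}  f = P.refl
  prodF≡prod {suc d} f = P.cong (f fz *_) (prodF≡prod (λ i → f (fs i)))

  prodF-nonzero : ∀ {d} (f : Fin d → Carrier) → (∀ i → ¬ (f i ≈ 0#)) → ¬ (prodF f ≈ 0#)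
  prodF-nonzero {zero}  f f≉0 = 1≉0
  prodF-nonzero {suc d} f f≉0 = *-nonzero (f≉0 fz) (prodF-nonzero _ (λ i → f≉0 (fs i)))

  -- Setoid bijections of the carrier, such as translations and scalings,
  -- permute the enumeration; hence they preserve counts, sums and products
  -- taken over the whole field.
  record Bijection : Set (c ⊔ ℓ) where
    field
      to from    : Carrier → Carrier
      to-cong    : ∀ {x y} → x ≈ y → to x ≈ to y
      from-cong  : ∀ {x y} → x ≈ y → from x ≈ from y
      to-from    : ∀ x → to (from x) ≈ x
      from-to    : ∀ x → from (to x) ≈ x

  module _ (β : Bijection) where
    open Bijection β

    private
      π σ : Fin N → Fin N
      π i = idx (to (en i))
      σ i = idx (from (en i))
      πσ : ∀ i → π (σ i) ≡ i
      πσ i = P.trans (idx-cong (trans (to-cong (sym (en-idx _))) (to-from (en i)))) (idx-en i)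
      σπ : ∀ i → σ (π i) ≡ i
      σπ i = P.trans (idx-cong (trans (from-cong (sym (en-idx _))) (from-to (en i)))) (idx-en i)
      en-π : ∀ i → to (en i) ≈ en (π i)
      en-π i = en-idx _
      perm : Permutation N N
      perm = mk↔ₛ′ π σ πσ σπ

    count-bij : ∀ {p} {U : Carrier → Set p} (U? : ∀ x → Dec (U x)) → (∀ {x y} → x ≈ y → U x → U y) →
                count (λ i → U? (to (en i))) ≡ count (λ i → U? (en i))
    count-bij U? U-resp =
      P.trans (count-ext (λ i → U? (to (en i))) (λ i → U? (en (π i)))
                         (λ i → U-resp (en-π i)) (λ i → U-resp (sym (en-π i))))
              (count-permute (λ i → U? (en i)) π σ πσ σπ)

    sumF-bij : ∀ (h : Carrier → Carrier) → (∀ {x y} → x ≈ y → h x ≈ h y) →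
               sumF (λ i → h (to (en i))) ≈ sumF (λ i → h (en i))
    sumF-bij h h-cong = begin
      sumF (λ i → h (to (en i)))       ≈⟨ sumF-cong (λ i → h-cong (en-π i)) ⟩
      sumF (λ i → h (en (π i)))        ≡⟨ sumF≡sum {N} _ ⟩
      +-Sum.sum (λ i → h (en (π i)))   ≈⟨ sym (+-Sum.sum-permute (λ i → h (en i)) perm) ⟩
      +-Sum.sum (λ i → h (en i))       ≡⟨ sumF≡sum {N} _ ⟨
      sumF (λ i → h (en i))            ∎

    prodF-bij : ∀ (h : Carrier → Carrier) → (∀ {x y} → x ≈ y → h x ≈ h y) →
                prodF (λ i → h (to (en i))) ≈ prodF (λ i → h (en i))
    prodF-bij h h-cong = begin
      prodF (λ i → h (to (en i)))      ≈⟨ prodF-cong (λ i → h-cong (en-π i)) ⟩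
      prodF (λ i → h (en (π i)))       ≡⟨ prodF≡prod {N} _ ⟩
      *-Sum.sum (λ i → h (en (π i)))   ≈⟨ sym (*-Sum.sum-permute (λ i → h (en i)) perm) ⟩
      *-Sum.sum (λ i → h (en i))       ≡⟨ prodF≡prod {N} _ ⟨
      prodF (λ i → h (en i))           ∎

  translation : Carrier → Bijection
  translation a = record
    { to = λ x → x + a ; from = λ x → x - a ; to-cong = +-congʳ ; from-cong = +-congʳ
    ; to-from = λ x → trans (+-assoc _ _ _) (trans (+-congˡ (-‿inverseˡ a)) (+-identityʳ x))
    ; from-to = λ x → trans (+-assoc _ _ _) (trans (+-congˡ (-‿inverseʳ a)) (+-identityʳ x)) }

  scaling : ∀ a → ¬ (a ≈ 0#) → Bijection
  scaling a a≉0 = record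
    { to = a *_ ; from = inv a a≉0 *_ ; to-cong = *-congˡ ; from-cong = *-congˡ
    ; to-from = λ x → trans (sym (*-assoc _ _ _)) (trans (*-congʳ (inv-r a a≉0)) (*-identityˡ x))
    ; from-to = λ x → trans (sym (*-assoc _ _ _)) (trans (*-congʳ (inv-l a a≉0)) (*-identityˡ x)) }

module Lagrange {c ℓ} (R : CommutativeRing c ℓ) (isField : FF.IsField R)
                (N : ℕ) (card : FF.HasCard R N) where
  open Counting
  import Algebra.Properties.Semiring.Mult as SemiringMultiples

  open FiniteField R isField N card public
  open SemiringMultiples semiring using (×-congʳ; ×-assoc-*; ×1-homo-*) renaming (_×_ to _·_)

  count-zero : count (λ i → en i ≟ 0#) ≡ 1
  count-zero = count-one (λ i → en i ≟ 0#) (idx 0#) (sym (en-idx 0#))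
                         (λ i j i≈0 j≈0 → en-injective i j (trans i≈0 (sym j≈0)))

  #units : ℕ
  #units = count (λ i → ¬? (en i ≟ 0#))

  #units+1≡N : #units +ℕ 1 ≡ N
  #units+1≡N = P.trans (ℕP.+-comm #units 1)
                 (P.trans (P.cong (_+ℕ #units) (P.sym count-zero)) (count-complement (λ i → en i ≟ 0#)))

  -- To multiply the units only, replace 0 by 1 in the product over the field.
  unit-or-1 : Carrier → Carrier
  unit-or-1 y with y ≟ 0#
  ... | yes _ = 1#
  ... | no _  = y

  unit-or-1-cong : ∀ {x y} → x ≈ y → unit-or-1 x ≈ unit-or-1 y
  unit-or-1-cong {x} {y} x≈y with x ≟ 0# | y ≟ 0#
  ... | yes _   | yes _   = refl
  ... | no _    | no _    = x≈y
  ... | yes x≈0 | no y≉0  = ⊥-elim (y≉0 (trans (sym x≈y) x≈0))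
  ... | no x≉0  | yes y≈0 = ⊥-elim (x≉0 (trans x≈y y≈0))

  unit-or-1-nonzero : ∀ y → ¬ (unit-or-1 y ≈ 0#)
  unit-or-1-nonzero y with y ≟ 0#
  ... | yes _  = 1≉0
  ... | no y≉0 = y≉0

  x-if-unit : Carrier → Carrier → Carrier
  x-if-unit x y with y ≟ 0#
  ... | yes _ = 1#
  ... | no _  = x

  unit-or-1-* : ∀ x y → ¬ (x ≈ 0#) → unit-or-1 (x * y) ≈ x-if-unit x y * unit-or-1 y
  unit-or-1-* x y x≉0 with y ≟ 0# | (x * y) ≟ 0#
  ... | yes _   | yes _    = sym (*-identityˡ 1#)
  ... | yes y≈0 | no xy≉0  = ⊥-elim (xy≉0 (trans (*-congˡ y≈0) (zeroʳ x)))
  ... | no y≉0  | yes xy≈0 = ⊥-elim (*-nonzero x≉0 y≉0 xy≈0)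
  ... | no _    | no _     = refl

  prodF-x-if-unit : ∀ {d} x (f : Fin d → Carrier) → prodF (λ i → x-if-unit x (f i)) ≈ pow x (count (λ i → ¬? (f i ≟ 0#)))
  prodF-x-if-unit {zero}  x f = refl
  prodF-x-if-unit {suc d} x f with f fz ≟ 0#
  ... | yes _ = trans (*-identityˡ _) (prodF-x-if-unit x (λ i → f (fs i)))
  ... | no _  = *-congˡ (prodF-x-if-unit x (λ i → f (fs i)))

  -- Lagrange for the unit group: multiplying all units by x permutes them.
  pow-#units : ∀ x → ¬ (x ≈ 0#) → pow x #units ≈ 1#
  pow-#units x x≉0 = *-cancelˡ G (prodF-nonzero _ (λ i → unit-or-1-nonzero (en i))) (begin
    G * pow x #units                                 ≈⟨ *-comm _ _ ⟩
    pow x #units * G                                 ≈⟨ *-congʳ (sym (prodF-x-if-unit x en)) ⟩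
    prodF (λ i → x-if-unit x (en i)) * G             ≈⟨ sym (prodF-* {N} _ _) ⟩
    prodF (λ i → x-if-unit x (en i) * unit-or-1 (en i)) ≈⟨ prodF-cong (λ i → sym (unit-or-1-* x (en i) x≉0)) ⟩
    prodF (λ i → unit-or-1 (x * en i))               ≈⟨ prodF-bij (scaling x x≉0) unit-or-1 unit-or-1-cong ⟩
    G                                                ≈⟨ sym (*-identityʳ G) ⟩
    G * 1#                                           ∎)
    where
    G : Carrier
    G = prodF (λ i → unit-or-1 (en i))

  pow-card : ∀ x → pow x N ≈ x
  pow-card x = begin
    pow x N                   ≈⟨ pow-≡ x (P.sym #units+1≡N) ⟩
    pow x (#units +ℕ 1)       ≈⟨ pow-+ x #units 1 ⟩
    pow x #units * pow x 1    ≈⟨ *-congˡ (*-identityʳ x) ⟩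
    pow x #units * x          ≈⟨ case-zero (x ≟ 0#) ⟩
    x                         ∎
    where
    case-zero : Dec (x ≈ 0#) → pow x #units * x ≈ x
    case-zero (yes x≈0) = trans (*-congˡ x≈0) (trans (zeroʳ _) (sym x≈0))
    case-zero (no x≉0)  = trans (*-congʳ (pow-#units x x≉0)) (*-identityˡ x)

  ι : ℕ → Carrier
  ι k = k · 1#

  ·≈ι* : ∀ n x → n · x ≈ ι n * x
  ·≈ι* n x = sym (trans (×-assoc-* n 1# x) (×-congʳ n (*-identityˡ x)))

  ι-* : ∀ a b → ι (a *ℕ b) ≈ ι a * ι b
  ι-* = ×1-homo-*

  ι-^ : ∀ a e → ι (a ^ℕ e) ≈ pow (ι a) e
  ι-^ a zero    = +-identityʳ 1#
  ι-^ a (suc e) = trans (ι-* a (a ^ℕ e)) (*-congˡ (ι-^ a e))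

  sumF-1# : ∀ {d} → sumF {d} (λ _ → 1#) ≈ ι d
  sumF-1# {zero}  = refl
  sumF-1# {suc d} = +-congˡ (sumF-1# {d})

  -- Translating by 1 permutes the field, so Σ x ≈ Σ (x + 1) ≈ Σ x + N·1.
  ι-card : ι N ≈ 0#
  ι-card = +-cancelʳ (sumF en) (begin
    ι N + sumF en                 ≈⟨ +-comm _ _ ⟩
    sumF en + ι N                 ≈⟨ +-congˡ (sym (sumF-1# {N})) ⟩
    sumF en + sumF {N} (λ _ → 1#) ≈⟨ sym (sumF-+ {N} en (λ _ → 1#)) ⟩
    sumF (λ i → en i + 1#)        ≈⟨ sumF-bij (translation 1#) (λ y → y) (λ x≈y → x≈y) ⟩
    sumF en                       ≈⟨ sym (+-identityˡ _) ⟩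
    0# + sumF en                  ∎)

module RootBound {c ℓ} (R : CommutativeRing c ℓ) (isField : FF.IsField R)
                 (N : ℕ) (card : FF.HasCard R N) where
  open Counting

  open Lagrange R isField N card public

  -- The monic polynomial x^D + Σ_{i<D} c i x^i, evaluated by Horner's rule.
  monic : ℕ → (ℕ → Carrier) → Carrier → Carrier
  monic zero    c x = 1#
  monic (suc D) c x = c 0 + x * monic D (λ i → c (suc i)) x

  -- Coefficients of the quotient of monic (suc D) c by (x - a).
  quotient : ℕ → (ℕ → Carrier) → Carrier → ℕ → Carrier
  quotient zero    c a _       = 0#
  quotient (suc D) c a zero    = monic (suc D) (λ i → c (suc i)) a
  quotient (suc D) c a (suc i) = quotient D (λ i → c (suc i)) a i

  private
    split-x : ∀ a x E → a * E + (x - a) * E ≈ x * E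
    split-x a x E = begin
      a * E + (x - a) * E   ≈⟨ sym (distribʳ E a (x - a)) ⟩
      (a + (x - a)) * E     ≈⟨ *-congʳ (trans (+-comm a _) (trans (+-assoc x (- a) a)
                                 (trans (+-congˡ (-‿inverseˡ a)) (+-identityʳ x)))) ⟩
      x * E                 ∎

    horner-step : ∀ c₀ x a E Q → c₀ + x * (E + (x - a) * Q) ≈ (c₀ + a * E) + (x - a) * (E + x * Q)
    horner-step c₀ x a E Q = begin
      c₀ + x * (E + (x - a) * Q)                         ≈⟨ +-congˡ (distribˡ x E _) ⟩
      c₀ + (x * E + x * ((x - a) * Q))                   ≈⟨ +-congˡ (+-cong (sym (split-x a x E)) (*-Props.x∙yz≈y∙xz x (x - a) Q)) ⟩
      c₀ + ((a * E + (x - a) * E) + (x - a) * (x * Q))   ≈⟨ +-congˡ (+-assoc _ _ _) ⟩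
      c₀ + (a * E + ((x - a) * E + (x - a) * (x * Q)))   ≈⟨ sym (+-assoc _ _ _) ⟩
      (c₀ + a * E) + ((x - a) * E + (x - a) * (x * Q))   ≈⟨ +-congˡ (sym (distribˡ (x - a) E _)) ⟩
      (c₀ + a * E) + (x - a) * (E + x * Q)               ∎

  remainder-theorem : ∀ D c a x → monic (suc D) c x ≈ monic (suc D) c a + (x - a) * monic D (quotient D c a) x
  remainder-theorem zero c a x = begin
    c 0 + x * 1#                  ≈⟨ +-congˡ (sym (split-x a x 1#)) ⟩
    c 0 + (a * 1# + (x - a) * 1#) ≈⟨ sym (+-assoc _ _ _) ⟩
    (c 0 + a * 1#) + (x - a) * 1# ∎
  remainder-theorem (suc D) c a x = begin
    c 0 + x * monic (suc D) c' x
      ≈⟨ +-congˡ (*-congˡ (remainder-theorem D c' a x)) ⟩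
    c 0 + x * (monic (suc D) c' a + (x - a) * monic D (quotient D c' a) x)
      ≈⟨ horner-step (c 0) x a _ _ ⟩
    (c 0 + a * monic (suc D) c' a) + (x - a) * (monic (suc D) c' a + x * monic D (quotient D c' a) x) ∎
    where c' = λ i → c (suc i)

  -- Induction on D: a root a splits off the linear factor x - a, which
  -- contributes only a itself.
  root-bound : ∀ D c → count (λ i → monic D c (en i) ≟ 0#) ≤ℕ D
  root-bound zero c = ℕP.≤-reflexive (count-none {d = N} (λ i → 1# ≟ 0#) (λ i → 1≉0))
  root-bound (suc D) c with FinP.any? {n = N} (λ i → monic (suc D) c (en i) ≟ 0#)
  ... | no no-root = ℕP.≤-trans (ℕP.≤-reflexive (count-none (λ i → monic (suc D) c (en i) ≟ 0#)
                                                   (λ i r → no-root (i , r)))) z≤n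
  ... | yes (i₀ , a-root) =
    ℕP.≤-trans (count-∪ (λ i → en i ≟ a) (λ i → monic D (quotient D c a) (en i) ≟ 0#)
                        (λ i → monic (suc D) c (en i) ≟ 0#) split)
               (ℕP.+-mono-≤ (count-≤1 (λ i → en i ≟ a) (λ i j i≈a j≈a → en-injective i j (trans i≈a (sym j≈a))))
                            (root-bound D (quotient D c a)))
    where
    a = en i₀
    split : ∀ i → monic (suc D) c (en i) ≈ 0# → en i ≈ a ⊎ monic D (quotient D c a) (en i) ≈ 0#
    split i root with no-zero-divisors {en i - a} {monic D (quotient D c a) (en i)} (begin
        (en i - a) * monic D (quotient D c a) (en i)                        ≈⟨ sym (+-identityˡ _) ⟩
        0# + (en i - a) * monic D (quotient D c a) (en i)                   ≈⟨ +-congʳ (sym a-root) ⟩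
        monic (suc D) c a + (en i - a) * monic D (quotient D c a) (en i)    ≈⟨ sym (remainder-theorem D c a (en i)) ⟩
        monic (suc D) c (en i)                                              ≈⟨ root ⟩
        0#                                                                  ∎)
    ... | inj₁ x-a≈0 = inj₁ (x-y≈0⇒x≈y x-a≈0)
    ... | inj₂ g≈0   = inj₂ g≈0

  monic≈sum : ∀ D c x → monic D c x ≈ pow x D + sumF (λ (i : Fin D) → c (toℕ i) * pow x (toℕ i))
  monic≈sum zero    c x = sym (+-identityʳ 1#)
  monic≈sum (suc D) c x = begin
    c 0 + x * monic D c' x         ≈⟨ +-congˡ (*-congˡ (monic≈sum D c' x)) ⟩
    c 0 + x * (pow x D + S)        ≈⟨ +-congˡ (distribˡ x _ _) ⟩
    c 0 + (x * pow x D + x * S)    ≈⟨ +-Props.x∙yz≈y∙xz _ _ _ ⟩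
    x * pow x D + (c 0 + x * S)    ≈⟨ +-congˡ (+-cong (sym (*-identityʳ _))
                                        (trans (sumF-*ˡ {D} x _) (sumF-cong {D} (λ i → *-Props.x∙yz≈y∙xz x _ _)))) ⟩
    x * pow x D + (c 0 * 1# + sumF (λ (i : Fin D) → c (suc (toℕ i)) * (x * pow x (toℕ i)))) ∎
    where
    c' = λ i → c (suc i)
    S = sumF (λ (i : Fin D) → c' (toℕ i) * pow x (toℕ i))

  roots-bound : ∀ {p} {U : Carrier → Set p} (U? : ∀ x → Dec (U x)) D c →
    (∀ x → U x → pow x D + sumF (λ (i : Fin D) → c (toℕ i) * pow x (toℕ i)) ≈ 0#) →
    count (λ i → U? (en i)) ≤ℕ D
  roots-bound U? D c U⊆roots =
    ℕP.≤-trans (count-mono (λ i → U? (en i)) (λ i → monic D c (en i) ≟ 0#)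
                           (λ i u → trans (monic≈sum D c (en i)) (U⊆roots (en i) u)))
               (root-bound D c)

-- Counting along an additive map: the fibres of an additive map φ on a
-- subgroup S are cosets of S ∩ ker φ, so |S| ≤ |T| · |S ∩ ker φ| whenever
-- φ maps S into T.
module Fibres {c ℓ} (R : CommutativeRing c ℓ) (isField : FF.IsField R)
              (N : ℕ) (card : FF.HasCard R N) where
  open Counting

  open RootBound R isField N card public

  record DecSubset {p} (S : Carrier → Set p) : Set (c ⊔ ℓ ⊔ p) where
    field
      dec  : ∀ x → Dec (S x)
      resp : ∀ {x y} → x ≈ y → S x → S y

  ∣_∣ : ∀ {p} {S : Carrier → Set p} → DecSubset S → ℕ
  ∣ S ∣ = count (λ i → DecSubset.dec S (en i))

  record Subgroup {p} (S : Carrier → Set p) : Set (c ⊔ ℓ ⊔ p) where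
    field
      decSubset : DecSubset S
      has-0     : S 0#
      +-closed  : ∀ {x y} → S x → S y → S (x + y)
      neg-closed : ∀ {x} → S x → S (- x)
    open DecSubset decSubset public

  record Additive (φ : Carrier → Carrier) : Set (c ⊔ ℓ) where
    field
      cong : ∀ {x y} → x ≈ y → φ x ≈ φ y
      +-homo : ∀ x y → φ (x + y) ≈ φ x + φ y

  module FibreBound {p p'} {S : Carrier → Set p} (S-subgroup : Subgroup S)
                    {φ} (φ-additive : Additive φ) {T : Carrier → Set p'} (T-dec : DecSubset T)
                    (φS⊆T : ∀ x → S x → T (φ x)) where
    private
      open Subgroup S-subgroup using () renaming (dec to S?; resp to S-resp)
      module φ = Additive φ-additive
      T? = DecSubset.dec T-dec

      Fibre : Fin N → Fin N → Set _
      Fibre t i = S (en i) × φ (en i) ≈ en t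
      Fibre? : ∀ t i → Dec (Fibre t i)
      Fibre? t i = S? (en i) ×-dec (φ (en i) ≟ en t)

    kernel : DecSubset (λ x → S x × φ x ≈ 0#)
    kernel = record { dec  = λ x → S? x ×-dec (φ x ≟ 0#)
                    ; resp = λ x≈y (s , φx≈0) → S-resp x≈y s , trans (sym (φ.cong x≈y)) φx≈0 }

    private
      S-as-union : ∣ Subgroup.decSubset S-subgroup ∣ ≡ Σℕ (λ t → χ (T? (en t)) *ℕ count (Fibre? t))
      S-as-union = double-count (λ t → T? (en t)) Fibre? (λ i → S? (en i))
        (λ i s → idx (φ (en i)) , DecSubset.resp T-dec (en-idx _) (φS⊆T _ s) , s , en-idx _)
        (λ i t _ → proj₁)
        (λ i t t' _ (_ , φi≈t) _ (_ , φi≈t') → en-injective t t' (trans (sym φi≈t) φi≈t'))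

      -- a nonempty fibre is a translate of the kernel
      fibre≡kernel : ∀ t i₀ → Fibre t i₀ → count (Fibre? t) ≡ ∣ kernel ∣
      fibre≡kernel t i₀ (s₀ , φx₀≈t) =
        P.trans (P.sym (count-bij (translation x₀) U? U-resp)) (count-ext _ _ to-kernel from-kernel)
        where
        x₀ = en i₀
        U : Carrier → Set _
        U y = S y × φ y ≈ en t
        U? : ∀ y → Dec (U y)
        U? y = S? y ×-dec (φ y ≟ en t)
        U-resp : ∀ {x y} → x ≈ y → U x → U y
        U-resp x≈y (s , φx≈t) = S-resp x≈y s , trans (sym (φ.cong x≈y)) φx≈t
        to-kernel : ∀ i → U (en i + x₀) → S (en i) × φ (en i) ≈ 0#
        to-kernel i (s , φ≈t) =
            S-resp (trans (+-assoc _ _ _) (trans (+-congˡ (-‿inverseʳ x₀)) (+-identityʳ _)))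
                   (Subgroup.+-closed S-subgroup s (Subgroup.neg-closed S-subgroup s₀))
          , +-cancelʳ (φ x₀) (trans (sym (φ.+-homo _ _)) (trans φ≈t (trans (sym φx₀≈t) (sym (+-identityˡ _)))))
        from-kernel : ∀ i → S (en i) × φ (en i) ≈ 0# → U (en i + x₀)
        from-kernel i (s , φ≈0) =
          Subgroup.+-closed S-subgroup s s₀ , trans (φ.+-homo _ _) (trans (+-cong φ≈0 φx₀≈t) (+-identityˡ _))

      fibre≤kernel : ∀ t → count (Fibre? t) ≤ℕ ∣ kernel ∣
      fibre≤kernel t with FinP.any? (Fibre? t)
      ... | yes (i₀ , f) = ℕP.≤-reflexive (fibre≡kernel t i₀ f)
      ... | no empty     = ℕP.≤-trans (ℕP.≤-reflexive (count-none (Fibre? t) (λ i f → empty (i , f)))) z≤n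

    fibre-bound : ∣ Subgroup.decSubset S-subgroup ∣ ≤ℕ ∣ T-dec ∣ *ℕ ∣ kernel ∣
    fibre-bound = ℕP.≤-trans (ℕP.≤-reflexive S-as-union)
                  (Σ-restricted-≤ (λ t → T? (en t)) (λ t → count (Fibre? t)) ∣ kernel ∣ (λ t _ → fibre≤kernel t))

module Frobenius {c ℓ} (R : CommutativeRing c ℓ) (isField : FF.IsField R)
                 (N : ℕ) (card : FF.HasCard R N)
                 (p : ℕ) (p-prime : Prime p) (e : ℕ) (N≡p^e : N ≡ p ^ℕ e) where
  open Arithmetic
  open import Data.Nat.Combinatorics using (_C_; nCn≡1; nCk≡nC[n∸k])
  import Algebra.Properties.Semiring.Binomial as BinomialTheorem
  import Algebra.Properties.Semiring.Exp as SemiringPowers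

  open Fibres R isField N card public

  -- p · 1 = 0, since (p · 1)^e = N · 1 = 0.
  ι-p : ι p ≈ 0#
  ι-p = pow≈0⇒≈0 e (trans (sym (ι-^ p e)) (trans (reflexive (P.cong ι (P.sym N≡p^e))) ι-card))

  private
    open SemiringPowers semiring using () renaming (_^_ to _^ᴿ_)

    ^ᴿ≈pow : ∀ x m → x ^ᴿ m ≈ pow x m
    ^ᴿ≈pow x zero    = refl
    ^ᴿ≈pow x (suc m) = *-congˡ (^ᴿ≈pow x m)

    expansion : ∀ x y p' → pow (x + y) (suc p') ≈ sumF (BinomialTheorem.binomialTerm semiring x y (suc p'))
    expansion x y p' = begin
      pow (x + y) (suc p')                                   ≈⟨ sym (^ᴿ≈pow (x + y) (suc p')) ⟩
      (x + y) ^ᴿ suc p'                                      ≈⟨ theorem (*-comm x y) (suc p') ⟩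
      binomialExpansion (suc p')                             ≡⟨ sumF≡sum (binomialTerm (suc p')) ⟨
      sumF (binomialTerm (suc p'))                           ∎
      where open BinomialTheorem semiring x y using (theorem; binomialExpansion; binomialTerm)

  -- Freshman's dream: (x + y)^p = x^p + y^p, because p divides all the
  -- inner binomial coefficients.
  frobenius-+ : ∀ x y → pow (x + y) p ≈ pow x p + pow y p
  frobenius-+ x y with prime≥2 p-prime
  ... | s≤s {n = p'} _ = begin
    pow (x + y) p                                 ≈⟨ expansion x y p' ⟩
    sumF term                                     ≈⟨ +-congˡ (sumF-single (λ i → term (fs i)) (fromℕ p') inner≈0) ⟩
    term fz + term (fs (fromℕ p'))                ≈⟨ +-comm _ _ ⟩
    term (fs (fromℕ p')) + term fz                ≈⟨ +-cong last-term first-term ⟩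
    pow x p + pow y p                             ∎
    where
    open BinomialTheorem semiring x y using (binomial; binomialTerm)
    term : Fin (suc p) → Carrier
    term = binomialTerm p

    term≈ : ∀ k → term k ≈ ι (p C toℕ k) * ((x ^ᴿ toℕ k) * (y ^ᴿ (p ∸ℕ toℕ k)))
    term≈ k = ·≈ι* (p C toℕ k) _

    inner≈0 : ∀ i → i ≢ fromℕ p' → term (fs i) ≈ 0#
    inner≈0 i i≢last with prime∣binomial p-prime (suc (toℕ i)) (s≤s z≤n) (s≤s i<p')
      where
      i<p' : toℕ i <ℕ p'
      i<p' = ℕP.≤∧≢⇒< (FinP.toℕ≤pred[n] i)
               (λ i≡p' → i≢last (FinP.toℕ-injective (P.trans i≡p' (P.sym (FinP.toℕ-fromℕ p')))))
    ... | divides d C≡d*p = begin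
      term (fs i)                                   ≈⟨ term≈ (fs i) ⟩
      ι (p C suc (toℕ i)) * _                        ≈⟨ *-congʳ (reflexive (P.cong ι C≡d*p)) ⟩
      ι (d *ℕ p) * _                                 ≈⟨ *-congʳ (trans (ι-* d p) (*-congˡ ι-p)) ⟩
      (ι d * 0#) * _                                 ≈⟨ trans (*-congʳ (zeroʳ _)) (zeroˡ _) ⟩
      0#                                             ∎

    first-term : term fz ≈ pow y p
    first-term = begin
      term fz                                        ≈⟨ term≈ fz ⟩
      ι (p C 0) * (1# * (y ^ᴿ p))
        ≈⟨ *-congʳ (reflexive (P.cong ι (P.trans (nCk≡nC[n∸k] {n = p} z≤n) (nCn≡1 p)))) ⟩
      ι 1 * (1# * (y ^ᴿ p))                          ≈⟨ *-cong (+-identityʳ 1#) (*-identityˡ _) ⟩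
      1# * (y ^ᴿ p)                                  ≈⟨ trans (*-identityˡ _) (^ᴿ≈pow y p) ⟩
      pow y p                                        ∎

    last-term : term (fs (fromℕ p')) ≈ pow x p
    last-term = begin
      term (fs (fromℕ p'))                           ≈⟨ term≈ (fs (fromℕ p')) ⟩
      ι (p C toℕ (fs (fromℕ p'))) * binomial p (fs (fromℕ p'))
        ≈⟨ reflexive (P.cong (λ k → ι (p C k) * ((x ^ᴿ k) * (y ^ᴿ (p ∸ℕ k)))) (P.cong suc (FinP.toℕ-fromℕ p'))) ⟩
      ι (p C p) * ((x ^ᴿ p) * (y ^ᴿ (p ∸ℕ p)))
        ≈⟨ *-cong (reflexive (P.cong ι (nCn≡1 p))) (*-congˡ (reflexive (P.cong (y ^ᴿ_) (ℕP.n∸n≡0 p)))) ⟩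
      ι 1 * ((x ^ᴿ p) * 1#)                          ≈⟨ *-cong (+-identityʳ 1#) (*-identityʳ _) ⟩
      1# * (x ^ᴿ p)                                  ≈⟨ trans (*-identityˡ _) (^ᴿ≈pow x p) ⟩
      pow x p                                        ∎

  frobenius^-+ : ∀ a x y → pow (x + y) (p ^ℕ a) ≈ pow x (p ^ℕ a) + pow y (p ^ℕ a)
  frobenius^-+ zero    x y = trans (*-identityʳ _) (sym (+-cong (*-identityʳ x) (*-identityʳ y)))
  frobenius^-+ (suc a) x y = begin
    pow (x + y) (p *ℕ p ^ℕ a)                        ≈⟨ pow-pow (x + y) p (p ^ℕ a) ⟩
    pow (pow (x + y) p) (p ^ℕ a)                     ≈⟨ pow-cong (p ^ℕ a) (frobenius-+ x y) ⟩
    pow (pow x p + pow y p) (p ^ℕ a)                 ≈⟨ frobenius^-+ a (pow x p) (pow y p) ⟩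
    pow (pow x p) (p ^ℕ a) + pow (pow y p) (p ^ℕ a)  ≈⟨ sym (+-cong (pow-pow x p (p ^ℕ a)) (pow-pow y p (p ^ℕ a))) ⟩
    pow x (p *ℕ p ^ℕ a) + pow y (p *ℕ p ^ℕ a)        ∎

  powerOf-+ : ∀ {Q} → IsPowerOf p Q → ∀ x y → pow (x + y) Q ≈ pow x Q + pow y Q
  powerOf-+ (a , P.refl) = frobenius^-+ a

  module FrobeniusMap {Q : ℕ} (Q-power : IsPowerOf p Q) where
    frob-+ : ∀ x y → pow (x + y) Q ≈ pow x Q + pow y Q
    frob-+ = powerOf-+ Q-power

    frob-0 : pow 0# Q ≈ 0#
    frob-0 = pow-zero Q (powerOf>0 p-prime Q-power)
      where
      pow-zero : ∀ Q → 0 <ℕ Q → pow 0# Q ≈ 0#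
      pow-zero (suc Q) _ = zeroˡ _

    frob-neg : ∀ x → pow (- x) Q ≈ - pow x Q
    frob-neg x = +-Group.inverseʳ-unique (pow x Q) (pow (- x) Q)
                   (trans (sym (frob-+ x (- x))) (trans (pow-cong Q (-‿inverseʳ x)) frob-0))

    frob-sum : ∀ {d} (f : Fin d → Carrier) → pow (sumF f) Q ≈ sumF (λ i → pow (f i) Q)
    frob-sum {zero}  f = frob-0
    frob-sum {suc d} f = trans (frob-+ _ _) (+-congˡ (frob-sum (λ i → f (fs i))))

-- The upper bound is the root bound for
-- x^Q - x; the lower bound comes from the additive map x ↦ x^Q - x, whose
-- image lies in the kernel of the trace Σ_{i≤d} y^(Q^i), a set of at most
-- Q^d elements (again by the root bound).
module Subfields {c ℓ} (R : CommutativeRing c ℓ) (isField : FF.IsField R)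
                 (N : ℕ) (card : FF.HasCard R N)
                 (p : ℕ) (p-prime : Prime p) (e : ℕ) (N≡p^e : N ≡ p ^ℕ e) where
  open Counting
  open Arithmetic using (IsPowerOf; powerOf-^)

  open Frobenius R isField N card p p-prime e N≡p^e public

  δ : ℕ → ℕ → Carrier
  δ a b with a ℕ.≟ b
  ... | yes _ = 1#
  ... | no _  = 0#

  δ-≢ : ∀ {a b} → a ≢ b → δ a b ≈ 0#
  δ-≢ {a} {b} a≢b with a ℕ.≟ b
  ... | yes a≡b = ⊥-elim (a≢b a≡b)
  ... | no _    = refl

  δ-≡ : ∀ a → δ a a ≈ 1#
  δ-≡ a with a ℕ.≟ a
  ... | yes _ = refl
  ... | no a≢a = ⊥-elim (a≢a P.refl)

  sumF-δ : ∀ {D} (g : ℕ → Carrier) k → k <ℕ D → sumF (λ (i : Fin D) → δ (toℕ i) k * g (toℕ i)) ≈ g k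
  sumF-δ {D} g k k<D = trans (sumF-single {D} _ (fromℕ< k<D) off-diagonal) on-diagonal
    where
    k≡ : toℕ (fromℕ< k<D) ≡ k
    k≡ = FinP.toℕ-fromℕ< k<D
    off-diagonal : ∀ i → i ≢ fromℕ< k<D → δ (toℕ i) k * g (toℕ i) ≈ 0#
    off-diagonal i i≢k = trans (*-congʳ (δ-≢ (λ i≡k → i≢k (FinP.toℕ-injective (P.trans i≡k (P.sym k≡))))))
                               (zeroˡ _)
    on-diagonal : δ (toℕ (fromℕ< k<D)) k * g (toℕ (fromℕ< k<D)) ≈ g k
    on-diagonal rewrite k≡ = trans (*-congʳ (δ-≡ k)) (*-identityˡ _)

  -- Tr Q (d + 1) is given by a monic polynomial of degree Q^d, hence has at
  -- most Q^d roots.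
  trace-kernel-bound : ∀ Q d → 1 <ℕ Q → count (λ i → Tr Q (suc d) (en i) ≟ 0#) ≤ℕ Q ^ℕ d
  trace-kernel-bound Q d 1<Q = roots-bound (λ x → Tr Q (suc d) x ≟ 0#) (Q ^ℕ d) coefficient as-monic
    where
    coefficient : ℕ → Carrier
    coefficient k = sumF (λ (j : Fin d) → δ k (Q ^ℕ toℕ j))
    as-monic : ∀ x → Tr Q (suc d) x ≈ 0# →
               pow x (Q ^ℕ d) + sumF (λ (i : Fin (Q ^ℕ d)) → coefficient (toℕ i) * pow x (toℕ i)) ≈ 0#
    as-monic x Tr≈0 = begin
      pow x D + sumF (λ (i : Fin D) → coefficient (toℕ i) * pow x (toℕ i))
        ≈⟨ +-congˡ (sumF-cong {D} (λ i → sumF-*ʳ {d} (pow x (toℕ i)) _)) ⟩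
      pow x D + sumF (λ (i : Fin D) → sumF (λ (j : Fin d) → δ (toℕ i) (Q ^ℕ toℕ j) * pow x (toℕ i)))
        ≈⟨ +-congˡ (sumF-swap {D} {d} _) ⟩
      pow x D + sumF (λ (j : Fin d) → sumF (λ (i : Fin D) → δ (toℕ i) (Q ^ℕ toℕ j) * pow x (toℕ i)))
        ≈⟨ +-congˡ (sumF-cong {d} (λ j → sumF-δ (pow x) (Q ^ℕ toℕ j) (ℕP.^-monoʳ-< Q 1<Q (FinP.toℕ<n j)))) ⟩
      pow x D + sumF (λ (j : Fin d) → pow x (Q ^ℕ toℕ j))
        ≈⟨ +-comm _ _ ⟩
      sumF (λ (j : Fin d) → pow x (Q ^ℕ toℕ j)) + pow x D
        ≈⟨ +-cong (sumF-cong {d} (λ j → pow-≡ x (P.cong (Q ^ℕ_) (P.sym (FinP.toℕ-inject₁ j)))))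
                  (pow-≡ x (P.cong (Q ^ℕ_) (P.sym (FinP.toℕ-fromℕ d)))) ⟩
      sumF (λ (j : Fin d) → pow x (Q ^ℕ toℕ (inject₁ j))) + pow x (Q ^ℕ toℕ (fromℕ d))
        ≈⟨ sym (sumF-last (λ (j : Fin (suc d)) → pow x (Q ^ℕ toℕ j))) ⟩
      Tr Q (suc d) x
        ≈⟨ Tr≈0 ⟩
      0#  ∎
      where D = Q ^ℕ d

  telescope : ∀ d (f : ℕ → Carrier) → sumF (λ (i : Fin d) → f (suc (toℕ i)) - f (toℕ i)) ≈ f d - f 0
  telescope zero    f = sym (-‿inverseʳ (f 0))
  telescope (suc d) f = begin
    (f 1 - f 0) + sumF (λ (i : Fin d) → f (suc (suc (toℕ i))) - f (suc (toℕ i)))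
                                      ≈⟨ +-congˡ (telescope d (λ k → f (suc k))) ⟩
    (f 1 - f 0) + (f (suc d) - f 1)   ≈⟨ +-comm _ _ ⟩
    (f (suc d) - f 1) + (f 1 - f 0)   ≈⟨ +-assoc _ _ _ ⟩
    f (suc d) + (- f 1 + (f 1 - f 0)) ≈⟨ +-congˡ (sym (+-assoc _ _ _)) ⟩
    f (suc d) + ((- f 1 + f 1) - f 0) ≈⟨ +-congˡ (+-congʳ (-‿inverseˡ _)) ⟩
    f (suc d) + (0# - f 0)            ≈⟨ +-congˡ (+-identityˡ _) ⟩
    f (suc d) - f 0                   ∎

  Fixed : (Q : ℕ) → DecSubset (λ x → pow x Q ≈ x)
  Fixed Q = record { dec = λ x → pow x Q ≟ x ; resp = λ x≈y xᵠ≈x → trans (sym (pow-cong Q x≈y)) (trans xᵠ≈x x≈y) }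

  -- They are roots of x^Q - x.
  fixed-≤ : ∀ Q → 1 <ℕ Q → ∣ Fixed Q ∣ ≤ℕ Q
  fixed-≤ Q 1<Q = roots-bound (λ x → pow x Q ≟ x) Q coefficient as-monic
    where
    coefficient : ℕ → Carrier
    coefficient k = δ k 1 * - 1#
    as-monic : ∀ x → pow x Q ≈ x → pow x Q + sumF (λ (i : Fin Q) → coefficient (toℕ i) * pow x (toℕ i)) ≈ 0#
    as-monic x xᵠ≈x = begin
      pow x Q + sumF (λ (i : Fin Q) → coefficient (toℕ i) * pow x (toℕ i))
        ≈⟨ +-cong xᵠ≈x (sumF-cong {Q} (λ i → *-Props.xy∙z≈xz∙y _ _ _)) ⟩
      x + sumF (λ (i : Fin Q) → δ (toℕ i) 1 * pow x (toℕ i) * - 1#)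
        ≈⟨ +-congˡ (sym (sumF-*ʳ {Q} (- 1#) _)) ⟩
      x + sumF (λ (i : Fin Q) → δ (toℕ i) 1 * pow x (toℕ i)) * - 1#
        ≈⟨ +-congˡ (*-congʳ (sumF-δ (pow x) 1 1<Q)) ⟩
      x + pow x 1 * - 1#     ≈⟨ +-congˡ (trans (*-comm _ _) (-1*x≈-x _)) ⟩
      x - pow x 1            ≈⟨ +-congˡ (-‿cong (*-identityʳ x)) ⟩
      x - x                  ≈⟨ -‿inverseʳ x ⟩
      0#                     ∎

  module SubfieldSize (Q d : ℕ) (Q-power : IsPowerOf p Q) (1<Q : 1 <ℕ Q) (Q^[d+1]≡N : Q ^ℕ suc d ≡ N) where
    open FrobeniusMap

    private
      L : Carrier → Carrier
      L x = pow x Q - x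

      L-additive : Additive L
      L-additive = record
        { cong   = λ x≈y → +-cong (pow-cong Q x≈y) (-‿cong x≈y)
        ; +-homo = λ x y → trans (+-cong (frob-+ Q-power x y) (-‿+ x y)) (+-Props.interchange _ _ _ _) }

      whole-field : Subgroup (λ _ → ⊤)
      whole-field = record { decSubset = record { dec = λ _ → yes tt ; resp = λ _ _ → tt }
                           ; has-0 = tt ; +-closed = λ _ _ → tt ; neg-closed = λ _ → tt }

      trace-kernel : DecSubset (λ x → Tr Q (suc d) x ≈ 0#)
      trace-kernel = record
        { dec  = λ x → Tr Q (suc d) x ≟ 0#
        ; resp = λ x≈y Tr≈0 → trans (sumF-cong {suc d} (λ i → pow-cong (Q ^ℕ toℕ i) (sym x≈y))) Tr≈0 }

      -- Tr (x^Q - x) telescopes to x^(Q^(d+1)) - x = x^N - x = 0.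
      Tr∘L≈0 : ∀ x → ⊤ → Tr Q (suc d) (L x) ≈ 0#
      Tr∘L≈0 x _ = begin
        Tr Q (suc d) (L x)
          ≈⟨ sumF-cong {suc d} (λ i → trans (frob-+ (powerOf-^ Q-power (toℕ i)) (pow x Q) (- x))
                                            (+-congˡ (frob-neg (powerOf-^ Q-power (toℕ i)) x))) ⟩
        sumF (λ (i : Fin (suc d)) → pow (pow x Q) (Q ^ℕ toℕ i) - pow x (Q ^ℕ toℕ i))
          ≈⟨ sumF-cong {suc d} (λ i → +-congʳ { - pow x (Q ^ℕ toℕ i)} (sym (pow-pow x Q (Q ^ℕ toℕ i)))) ⟩
        sumF (λ (i : Fin (suc d)) → pow x (Q ^ℕ suc (toℕ i)) - pow x (Q ^ℕ toℕ i))
          ≈⟨ telescope (suc d) (λ k → pow x (Q ^ℕ k)) ⟩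
        pow x (Q ^ℕ suc d) - pow x 1
          ≈⟨ +-cong (trans (pow-≡ x Q^[d+1]≡N) (pow-card x)) (-‿cong (*-identityʳ x)) ⟩
        x - x ≈⟨ -‿inverseʳ x ⟩
        0#    ∎

      open FibreBound whole-field L-additive trace-kernel Tr∘L≈0

      kernel≡Fixed : ∣ kernel ∣ ≡ ∣ Fixed Q ∣
      kernel≡Fixed = count-ext {d = N} _ _ (λ i (_ , Lx≈0) → x-y≈0⇒x≈y Lx≈0) (λ i fixed → tt , x≈y⇒x-y≈0 fixed)

      -- Q^(d+1) = N ≤ |ker Tr| · |ker L| ≤ Q^d · |Fixed Q|
      Q^[d+1]≤Q^d*fixed : Q ^ℕ suc d ≤ℕ Q ^ℕ d *ℕ ∣ Fixed Q ∣
      Q^[d+1]≤Q^d*fixed =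
        ℕP.≤-trans (ℕP.≤-reflexive (P.trans Q^[d+1]≡N (P.sym (count-all {d = N} (λ i → yes tt) (λ _ → tt)))))
        (ℕP.≤-trans fibre-bound
                    (ℕP.*-mono-≤ (trace-kernel-bound Q d 1<Q) (ℕP.≤-reflexive kernel≡Fixed)))

      Q≤fixed : Q ≤ℕ ∣ Fixed Q ∣
      Q≤fixed = ℕP.*-cancelˡ-≤ (Q ^ℕ d) {{ℕP.m^n≢0 Q d {{ℕ.>-nonZero (ℕP.<-trans (s≤s z≤n) 1<Q)}}}}
                  (ℕP.≤-trans (ℕP.≤-reflexive (ℕP.*-comm (Q ^ℕ d) Q)) Q^[d+1]≤Q^d*fixed)

    fixed-count : ∣ Fixed Q ∣ ≡ Q
    fixed-count = ℕP.≤-antisym (fixed-≤ Q 1<Q) Q≤fixed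

-- Linear algebra over the subfield F_q = {x | x^q = x}: the span of d
-- linearly independent vectors has q^d elements (double counting over the
-- first coordinate), and consequently every subfield F_{q^s} of size q^s has
-- an F_q-basis, built greedily by adding vectors outside the current span.
module Linear {c ℓ} (R : CommutativeRing c ℓ) (isField : FF.IsField R)
              (N : ℕ) (card : FF.HasCard R N)
              (p : ℕ) (p-prime : Prime p) (e : ℕ) (N≡p^e : N ≡ p ^ℕ e)
              (q : ℕ) (q-power : Arithmetic.IsPowerOf p q) (1<q : 1 <ℕ q) where
  open Counting
  open Arithmetic using (IsPowerOf; powerOf-^)

  open Subfields R isField N card p p-prime e N≡p^e public
  open FrobeniusMap

  Scalar : Carrier → Set ℓ
  Scalar = InSub q 1

  Scalar? : ∀ x → Dec (Scalar x)
  Scalar? x = pow x (q ^ℕ 1) ≟ x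

  scalar-pow : ∀ {x} → Scalar x → ∀ s → pow x (q ^ℕ s) ≈ x
  scalar-pow         x∈Fq zero    = *-identityʳ _
  scalar-pow {x = x} x∈Fq (suc s) = begin
    pow x (q *ℕ q ^ℕ s)        ≈⟨ pow-pow x q (q ^ℕ s) ⟩
    pow (pow x q) (q ^ℕ s)     ≈⟨ pow-cong (q ^ℕ s) (trans (pow-≡ x (P.sym (ℕP.*-identityʳ q))) x∈Fq) ⟩
    pow x (q ^ℕ s)             ≈⟨ scalar-pow x∈Fq s ⟩
    x                          ∎

  module Subfield (s : ℕ) where
    private
      Q-power : IsPowerOf p (q ^ℕ s)
      Q-power = powerOf-^ q-power s

    InF : Carrier → Set ℓ
    InF = InSub q s

    InF? : ∀ x → Dec (InF x)
    InF? x = pow x (q ^ℕ s) ≟ x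

    F-resp : ∀ {x y} → x ≈ y → InF x → InF y
    F-resp = DecSubset.resp (Fixed (q ^ℕ s))

    F-0 : InF 0#
    F-0 = frob-0 Q-power

    F-1 : InF 1#
    F-1 = pow-1# (q ^ℕ s)

    F-+ : ∀ {x y} → InF x → InF y → InF (x + y)
    F-+ {x} {y} x∈F y∈F = trans (frob-+ Q-power x y) (+-cong x∈F y∈F)

    F-neg : ∀ {x} → InF x → InF (- x)
    F-neg {x} x∈F = trans (frob-neg Q-power x) (-‿cong x∈F)

    F-* : ∀ {x y} → InF x → InF y → InF (x * y)
    F-* {x} {y} x∈F y∈F = trans (pow-* x y (q ^ℕ s)) (*-cong x∈F y∈F)

    F-inv : ∀ {x} (x≉0 : ¬ (x ≈ 0#)) → InF x → InF (inv x x≉0)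
    F-inv {x} x≉0 x∈F = *-cancelˡ x x≉0 (begin
      x * pow (inv x x≉0) (q ^ℕ s)                  ≈⟨ *-congʳ (sym x∈F) ⟩
      pow x (q ^ℕ s) * pow (inv x x≉0) (q ^ℕ s)     ≈⟨ sym (pow-* x (inv x x≉0) (q ^ℕ s)) ⟩
      pow (x * inv x x≉0) (q ^ℕ s)                  ≈⟨ pow-cong (q ^ℕ s) (inv-r x x≉0) ⟩
      pow 1# (q ^ℕ s)                               ≈⟨ F-1 ⟩
      1#                                            ≈⟨ sym (inv-r x x≉0) ⟩
      x * inv x x≉0                                 ∎)

    F-scalar* : ∀ {a x} → Scalar a → InF x → InF (a * x)
    F-scalar* {a} {x} a∈Fq x∈F = trans (pow-* a x (q ^ℕ s)) (*-cong (scalar-pow a∈Fq s) x∈F)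

    F-sum : ∀ {d} (f : Fin d → Carrier) → (∀ i → InF (f i)) → InF (sumF f)
    F-sum {zero}  f f∈F = F-0
    F-sum {suc d} f f∈F = F-+ (f∈F fz) (F-sum (λ i → f (fs i)) (λ i → f∈F (fs i)))

  open Subfield 1 public using () renaming
    (F-0 to scalar-0; F-1 to scalar-1; F-+ to scalar-+; F-neg to scalar-neg; F-* to scalar-*;
     F-inv to scalar-inv; F-resp to scalar-resp)

  LinComb : ∀ {d} → (Fin d → Carrier) → Carrier → Set (c ⊔ ℓ)
  LinComb {d} v x = ∃ λ (λ' : Fin d → Carrier) → (∀ i → Scalar (λ' i)) × (x ≈ sumF (λ i → λ' i * v i))

  -- A decidable characterisation of the span, by searching the coefficient
  -- of the first vector among the scalars.
  InSpan : (d : ℕ) → (Fin d → Carrier) → Carrier → Set (c ⊔ ℓ)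
  InSpan zero    v x = Lift c (x ≈ 0#)
  InSpan (suc d) v x = ∃ λ (t : Fin N) → Scalar (en t) × InSpan d (λ i → v (fs i)) (x - en t * v fz)

  InSpan? : ∀ d v x → Dec (InSpan d v x)
  InSpan? zero    v x with x ≟ 0#
  ... | yes x≈0 = yes (lift x≈0)
  ... | no x≉0  = no (λ x≈0 → x≉0 (lower x≈0))
  InSpan? (suc d) v x = FinP.any? (λ t → Scalar? (en t) ×-dec InSpan? d (λ i → v (fs i)) (x - en t * v fz))

  InSpan-resp : ∀ d v {x y} → x ≈ y → InSpan d v x → InSpan d v y
  InSpan-resp zero    v x≈y (lift x≈0)     = lift (trans (sym x≈y) x≈0)
  InSpan-resp (suc d) v x≈y (t , t∈Fq , s) = t , t∈Fq , InSpan-resp d _ (+-congʳ x≈y) s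

  Span : ∀ d v → DecSubset (InSpan d v)
  Span d v = record { dec = InSpan? d v ; resp = InSpan-resp d v }

  private
    peel : ∀ x a → x ≈ a + (x - a)
    peel x a = begin
      x                  ≈⟨ sym (+-identityʳ x) ⟩
      x + 0#             ≈⟨ +-congˡ (sym (-‿inverseˡ a)) ⟩
      x + (- a + a)      ≈⟨ sym (+-assoc _ _ _) ⟩
      (x - a) + a        ≈⟨ +-comm _ _ ⟩
      a + (x - a)        ∎

    unpeel : ∀ a S → (a + S) - a ≈ S
    unpeel a S = trans (+-congʳ (+-comm a S)) (trans (+-assoc _ _ _) (trans (+-congˡ (-‿inverseʳ a)) (+-identityʳ S)))

  InSpan⇒LinComb : ∀ d v x → InSpan d v x → LinComb v x
  InSpan⇒LinComb zero    v x (lift x≈0)     = (λ ()) , (λ ()) , x≈0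
  InSpan⇒LinComb (suc d) v x (t , t∈Fq , s) with InSpan⇒LinComb d (λ i → v (fs i)) _ s
  ... | μ , μ∈Fq , x-tv≈Σ =
      (λ { fz → en t ; (fs i) → μ i }) , (λ { fz → t∈Fq ; (fs i) → μ∈Fq i })
    , trans (peel x (en t * v fz)) (+-congˡ x-tv≈Σ)

  LinComb⇒InSpan : ∀ d v x → LinComb v x → InSpan d v x
  LinComb⇒InSpan zero    v x (μ , μ∈Fq , x≈Σ) = lift x≈Σ
  LinComb⇒InSpan (suc d) v x (μ , μ∈Fq , x≈Σ) =
      idx (μ fz) , scalar-resp (en-idx _) (μ∈Fq fz)
    , LinComb⇒InSpan d (λ i → v (fs i)) _ ((λ i → μ (fs i)) , (λ i → μ∈Fq (fs i)) , (begin
        x - en (idx (μ fz)) * v fz    ≈⟨ +-congˡ (-‿cong (*-congʳ (sym (en-idx _)))) ⟩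
        x - μ fz * v fz               ≈⟨ +-congʳ x≈Σ ⟩
        (μ fz * v fz + S) - μ fz * v fz  ≈⟨ unpeel _ S ⟩
        S                             ∎))
    where S = sumF (λ i → μ (fs i) * v (fs i))

  lc-+ : ∀ {d} (v : Fin d → Carrier) {x y} → LinComb v x → LinComb v y → LinComb v (x + y)
  lc-+ {d} v (a , a∈Fq , x≈) (b , b∈Fq , y≈) =
      (λ i → a i + b i) , (λ i → scalar-+ (a∈Fq i) (b∈Fq i))
    , trans (+-cong x≈ y≈) (trans (sym (sumF-+ {d} _ _)) (sumF-cong {d} (λ i → sym (distribʳ (v i) (a i) (b i)))))

  lc-* : ∀ {d} (v : Fin d → Carrier) {k x} → Scalar k → LinComb v x → LinComb v (k * x)
  lc-* {d} v {k} k∈Fq (a , a∈Fq , x≈) =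
      (λ i → k * a i) , (λ i → scalar-* k∈Fq (a∈Fq i))
    , trans (*-congˡ x≈) (trans (sumF-*ˡ {d} k _) (sumF-cong {d} (λ i → sym (*-assoc k (a i) (v i)))))

  lc-neg : ∀ {d} (v : Fin d → Carrier) {x} → LinComb v x → LinComb v (- x)
  lc-neg v {x} x∈ with lc-* v (scalar-neg scalar-1) x∈
  ... | a , a∈Fq , -1x≈ = a , a∈Fq , trans (sym (-1*x≈-x x)) -1x≈

  lc-resp : ∀ {d} (v : Fin d → Carrier) {x y} → x ≈ y → LinComb v x → LinComb v y
  lc-resp v x≈y (a , a∈Fq , x≈) = a , a∈Fq , trans (sym x≈y) x≈

  cons : ∀ {d} → Carrier → (Fin d → Carrier) → Fin (suc d) → Carrier
  cons a v fz     = a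
  cons a v (fs i) = v i

  indep-[] : LinIndep q {0} (λ ())
  indep-[] μ μ∈Fq Σ≈0 ()

  indep-tail : ∀ {d} (v : Fin (suc d) → Carrier) → LinIndep q v → LinIndep q (λ i → v (fs i))
  indep-tail v indep μ μ∈Fq Σ≈0 i =
    indep (cons 0# μ) (λ { fz → scalar-0 ; (fs j) → μ∈Fq j }) (trans (+-cong (zeroˡ _) Σ≈0) (+-identityʳ 0#)) (fs i)

  indep-head : ∀ {d} (v : Fin (suc d) → Carrier) → LinIndep q v → ¬ InSpan d (λ i → v (fs i)) (v fz)
  indep-head {d} v indep v₀∈span with InSpan⇒LinComb d _ _ v₀∈span
  ... | μ , μ∈Fq , v₀≈Σ = 1≉0 (trans (sym (+-Group.⁻¹-involutive 1#)) (trans (-‿cong -1≈0) -‿0))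
    where
    -1≈0 : - 1# ≈ 0#
    -1≈0 = indep (cons (- 1#) μ) (λ { fz → scalar-neg scalar-1 ; (fs j) → μ∈Fq j })
                 (trans (+-cong (-1*x≈-x _) (sym v₀≈Σ)) (-‿inverseˡ _)) fz

  indep-cons : ∀ {d} (v : Fin (suc d) → Carrier) → LinIndep q (λ i → v (fs i)) →
               ¬ InSpan d (λ i → v (fs i)) (v fz) → LinIndep q v
  indep-cons {d} v indep v₀∉span μ μ∈Fq Σ≈0 = all≈0
    where
    S = sumF (λ i → μ (fs i) * v (fs i))
    μ₀≈0 : μ fz ≈ 0#
    μ₀≈0 with μ fz ≟ 0#
    ... | yes μ₀≈0 = μ₀≈0
    ... | no μ₀≉0  = ⊥-elim (v₀∉span (LinComb⇒InSpan d _ _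
            (lc-resp _ v₀≈ (lc-* _ (scalar-neg (scalar-inv μ₀≉0 (μ∈Fq fz)))
                                   ((λ i → μ (fs i)) , (λ i → μ∈Fq (fs i)) , refl)))))
      where
      μ₀⁻¹ = inv (μ fz) μ₀≉0
      -μ₀v₀≈S : - (μ fz * v fz) ≈ S
      -μ₀v₀≈S = sym (+-Group.inverseʳ-unique (μ fz * v fz) S Σ≈0)
      v₀≈ : - μ₀⁻¹ * S ≈ v fz
      v₀≈ = begin
        - μ₀⁻¹ * S                        ≈⟨ *-congˡ (sym -μ₀v₀≈S) ⟩
        - μ₀⁻¹ * (- (μ fz * v fz))        ≈⟨ sym (-‿distribˡ-* _ _) ⟩
        - (μ₀⁻¹ * (- (μ fz * v fz)))      ≈⟨ -‿cong (sym (-‿distribʳ-* _ _)) ⟩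
        - (- (μ₀⁻¹ * (μ fz * v fz)))      ≈⟨ +-Group.⁻¹-involutive _ ⟩
        μ₀⁻¹ * (μ fz * v fz)              ≈⟨ sym (*-assoc _ _ _) ⟩
        (μ₀⁻¹ * μ fz) * v fz              ≈⟨ *-congʳ (inv-l _ μ₀≉0) ⟩
        1# * v fz                         ≈⟨ *-identityˡ _ ⟩
        v fz                              ∎
    tail≈0 : ∀ i → μ (fs i) ≈ 0#
    tail≈0 = indep (λ i → μ (fs i)) (λ i → μ∈Fq (fs i))
               (trans (sym (+-identityˡ S)) (trans (+-congʳ (sym (trans (*-congʳ μ₀≈0) (zeroˡ _)))) Σ≈0))
    all≈0 : ∀ i → μ i ≈ 0#
    all≈0 fz     = μ₀≈0
    all≈0 (fs i) = tail≈0 i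

  module Dimension (Fq-size : ∣ Fixed (q ^ℕ 1) ∣ ≡ q) where

    -- An independent family of d vectors spans q^d elements: the span is
    -- the disjoint union, over the scalars t, of the translates by t·v₀ of
    -- the span of the remaining d - 1 vectors.
    span-size : ∀ d (v : Fin d → Carrier) → LinIndep q v → ∣ Span d v ∣ ≡ q ^ℕ d
    span-size zero    v indep = count-one (λ i → InSpan? 0 v (en i)) (idx 0#) (lift (sym (en-idx 0#)))
                                  (λ i j i≈0 j≈0 → en-injective i j (trans (lower i≈0) (sym (lower j≈0))))
    span-size (suc d) v indep =
      P.trans as-union (P.trans (Σ-restricted-≡ (λ t → Scalar? (en t)) _ (q ^ℕ d) slice-size)
                                (P.cong (_*ℕ q ^ℕ d) Fq-size))
      where
      v' : Fin d → Carrier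
      v' i = v (fs i)
      Slice? : ∀ t i → Dec (InSpan d v' (en i - en t * v fz))
      Slice? t i = InSpan? d v' (en i - en t * v fz)
      -- two different first coordinates would put v₀ in the span of v'
      coordinate-unique : ∀ i t t' → Scalar (en t) → InSpan d v' (en i - en t * v fz) →
                          Scalar (en t') → InSpan d v' (en i - en t' * v fz) → t ≡ t'
      coordinate-unique i t t' t∈Fq s t'∈Fq s' with en t ≟ en t'
      ... | yes t≈t' = en-injective t t' t≈t'
      ... | no t≉t'  = ⊥-elim (indep-head v indep (LinComb⇒InSpan d v' (v fz)
                         (lc-resp v' cancel (lc-* v' (scalar-inv a-b≉0 (scalar-+ t∈Fq (scalar-neg t'∈Fq))) ab-v₀∈))))
        where
        a = en t
        b = en t'
        a-b≉0 : ¬ (a - b ≈ 0#)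
        a-b≉0 a-b≈0 = t≉t' (x-y≈0⇒x≈y a-b≈0)
        difference : (en i - b * v fz) - (en i - a * v fz) ≈ (a - b) * v fz
        difference = begin
          (en i - b * v fz) - (en i - a * v fz)   ≈⟨ +-congˡ (trans (-‿+ _ _) (+-congˡ (+-Group.⁻¹-involutive _))) ⟩
          (en i - b * v fz) + (- en i + a * v fz) ≈⟨ +-Props.interchange _ _ _ _ ⟩
          (en i - en i) + (- (b * v fz) + a * v fz) ≈⟨ +-congʳ (-‿inverseʳ _) ⟩
          0# + (- (b * v fz) + a * v fz)          ≈⟨ trans (+-identityˡ _) (+-comm _ _) ⟩
          a * v fz - b * v fz                     ≈⟨ +-congˡ (-‿distribˡ-* b (v fz)) ⟩
          a * v fz + - b * v fz                   ≈⟨ sym (distribʳ (v fz) a (- b)) ⟩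
          (a - b) * v fz                          ∎
        ab-v₀∈ : LinComb v' ((a - b) * v fz)
        ab-v₀∈ = lc-resp v' difference (lc-+ v' (InSpan⇒LinComb d v' _ s') (lc-neg v' (InSpan⇒LinComb d v' _ s)))
        cancel : inv (a - b) a-b≉0 * ((a - b) * v fz) ≈ v fz
        cancel = trans (sym (*-assoc _ _ _)) (trans (*-congʳ (inv-l _ a-b≉0)) (*-identityˡ _))
      as-union : ∣ Span (suc d) v ∣ ≡ Σℕ (λ t → χ (Scalar? (en t)) *ℕ count (Slice? t))
      as-union = double-count (λ t → Scalar? (en t)) Slice? (λ i → InSpan? (suc d) v (en i))
                   (λ i s → s) (λ i t t∈Fq s → t , t∈Fq , s) coordinate-unique
      -- each slice is a translate of the span of v'
      slice-size : ∀ t → Scalar (en t) → count (Slice? t) ≡ q ^ℕ d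
      slice-size t _ = P.trans (count-bij (translation (- (en t * v fz))) (InSpan? d v') (InSpan-resp d v'))
                               (span-size d v' (indep-tail v indep))

    module BasisOf (s : ℕ) (F-size : ∣ Fixed (q ^ℕ s) ∣ ≡ q ^ℕ s) where
      open Subfield s

      span⊆F : ∀ {d} (v : Fin d → Carrier) → (∀ i → InF (v i)) → ∀ {x} → LinComb v x → InF x
      span⊆F v v∈F (μ , μ∈Fq , x≈Σ) = F-resp (sym x≈Σ) (F-sum _ (λ i → F-scalar* (μ∈Fq i) (v∈F i)))

      span-≤ : ∀ d (v : Fin d → Carrier) → (∀ i → InF (v i)) → ∣ Span d v ∣ ≤ℕ q ^ℕ s
      span-≤ d v v∈F = ℕP.≤-trans (count-mono (λ i → InSpan? d v (en i)) (λ i → InF? (en i))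
                                              (λ i x∈span → span⊆F v v∈F (InSpan⇒LinComb d v _ x∈span)))
                                  (ℕP.≤-reflexive F-size)

      -- For d ≤ s an independent family of d elements of F exists: if all of F
      -- lay in the span of d - 1 < s of them, F would have < q^s elements.
      independent-family : ∀ d → d ≤ℕ s → Σ (Fin d → Carrier) λ v → (∀ i → InF (v i)) × LinIndep q v
      independent-family zero    _   = (λ ()) , (λ ()) , indep-[]
      independent-family (suc d) d<s with independent-family d (ℕP.≤-trans (ℕP.n≤1+n d) d<s)
      ... | v , v∈F , indep with FinP.any? (λ i → InF? (en i) ×-dec ¬? (InSpan? d v (en i)))
      ...   | yes (i , x∈F , x∉span) =
        cons (en i) v , (λ { fz → x∈F ; (fs j) → v∈F j }) , indep-cons (cons (en i) v) indep x∉span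
      ...   | no F⊆span = ⊥-elim (ℕP.<⇒≱ (ℕP.^-monoʳ-< q 1<q d<s)
          (ℕP.≤-trans (ℕP.≤-reflexive (P.sym F-size))
            (ℕP.≤-trans (count-mono (λ i → InF? (en i)) (λ i → InSpan? d v (en i)) in-span)
                        (ℕP.≤-reflexive (span-size d v indep)))))
        where
        in-span : ∀ i → InF (en i) → InSpan d v (en i)
        in-span i x∈F with InSpan? d v (en i)
        ... | yes x∈span = x∈span
        ... | no x∉span  = ⊥-elim (F⊆span (i , x∈F , x∉span))

      -- An independent family of s elements spans F: adding an element
      -- outside the span would give q^(s+1) elements in F.
      basis : Σ (Fin s → Carrier) (IsBasis q s)
      basis with independent-family s ℕP.≤-refl
      ... | v , v∈F , indep = v , v∈F , indep , spans
        where
        spans : Spans q s v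
        spans x x∈F with InSpan? s v x
        ... | yes x∈span = InSpan⇒LinComb s v x x∈span
        ... | no x∉span  = ⊥-elim (ℕP.<⇒≱ (ℕP.^-monoʳ-< q 1<q (ℕP.n<1+n s))
                 (ℕP.≤-trans (ℕP.≤-reflexive (P.sym (span-size (suc s) (cons x v) (indep-cons (cons x v) indep x∉span))))
                             (span-≤ (suc s) (cons x v) (λ { fz → x∈F ; (fs j) → v∈F j }))))

module Trace {c ℓ} (R : CommutativeRing c ℓ) (isField : FF.IsField R)
             (N : ℕ) (card : FF.HasCard R N)
             (p : ℕ) (p-prime : Prime p) (e : ℕ) (N≡p^e : N ≡ p ^ℕ e)
             (q : ℕ) (q-power : Arithmetic.IsPowerOf p q) (1<q : 1 <ℕ q)
             (n' : ℕ) (q^n≡N : q ^ℕ suc n' ≡ N) where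
  open Counting
  open Arithmetic using (IsPowerOf; powerOf-^)

  open Linear R isField N card p p-prime e N≡p^e q q-power 1<q public
  open FrobeniusMap

  n : ℕ
  n = suc n'

  tr : Carrier → Carrier
  tr = Tr q n

  in-F_qⁿ : ∀ x → InSub q n x
  in-F_qⁿ x = trans (pow-≡ x q^n≡N) (pow-card x)

  pow-q^[nw] : ∀ w x → pow x (q ^ℕ (n *ℕ w)) ≈ x
  pow-q^[nw] w x = trans (pow-≡ x (P.sym (ℕP.^-*-assoc q n w))) (iterate w)
    where
    iterate : ∀ w → pow x ((q ^ℕ n) ^ℕ w) ≈ x
    iterate zero    = *-identityʳ x
    iterate (suc w) = trans (pow-pow x (q ^ℕ n) ((q ^ℕ n) ^ℕ w))
                            (trans (pow-cong ((q ^ℕ n) ^ℕ w) (in-F_qⁿ x)) (iterate w))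

  tr-cong : ∀ {x y} → x ≈ y → tr x ≈ tr y
  tr-cong x≈y = sumF-cong {n} (λ i → pow-cong (q ^ℕ toℕ i) x≈y)

  tr-+ : ∀ x y → tr (x + y) ≈ tr x + tr y
  tr-+ x y = trans (sumF-cong {n} (λ i → frob-+ (powerOf-^ q-power (toℕ i)) x y))
                   (sumF-+ {n} (λ i → pow x (q ^ℕ toℕ i)) (λ i → pow y (q ^ℕ toℕ i)))

  tr-0 : tr 0# ≈ 0#
  tr-0 = sumF-zero {n} (λ i → pow 0# (q ^ℕ toℕ i)) (λ i → frob-0 (powerOf-^ q-power (toℕ i)))

  tr-scalar* : ∀ {a} → Scalar a → ∀ y → tr (a * y) ≈ a * tr y
  tr-scalar* {a} a∈Fq y =
    trans (sumF-cong {n} (λ i → trans (pow-* a y (q ^ℕ toℕ i)) (*-congʳ (scalar-pow a∈Fq (toℕ i)))))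
          (sym (sumF-*ˡ {n} a (λ i → pow y (q ^ℕ toℕ i))))

  tr-neg : ∀ y → tr (- y) ≈ - tr y
  tr-neg y = trans (tr-cong (sym (-1*x≈-x y))) (trans (tr-scalar* (scalar-neg scalar-1) y) (-1*x≈-x _))

  tr-sum : ∀ {d} (f : Fin d → Carrier) → tr (sumF f) ≈ sumF (λ i → tr (f i))
  tr-sum {zero}  f = tr-0
  tr-sum {suc d} f = trans (tr-+ _ _) (+-congˡ (tr-sum (λ i → f (fs i))))

  -- Tr(y^q) = Tr(y): the Frobenius permutes the summands cyclically.
  tr-frobenius : ∀ y → tr (pow y q) ≈ tr y
  tr-frobenius y = begin
    sumF (λ (i : Fin n) → pow (pow y q) (q ^ℕ toℕ i))   ≈⟨ sumF-cong {n} (λ i → sym (pow-pow y q (q ^ℕ toℕ i))) ⟩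
    sumF (λ (i : Fin n) → f (suc (toℕ i)))               ≈⟨ sumF-last {n'} (λ i → f (suc (toℕ i))) ⟩
    sumF (λ (i : Fin n') → f (suc (toℕ (inject₁ i)))) + f (suc (toℕ (fromℕ n')))
      ≈⟨ +-cong (sumF-cong {n'} (λ i → reflexive (P.cong (λ k → f (suc k)) (FinP.toℕ-inject₁ i))))
                (reflexive (P.cong (λ k → f (suc k)) (FinP.toℕ-fromℕ n'))) ⟩
    sumF (λ (i : Fin n') → f (suc (toℕ i))) + f n       ≈⟨ +-comm _ _ ⟩
    f n + sumF (λ (i : Fin n') → f (suc (toℕ i)))       ≈⟨ +-congʳ (trans (in-F_qⁿ y) (sym (*-identityʳ y))) ⟩
    f 0 + sumF (λ (i : Fin n') → f (suc (toℕ i)))       ∎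
    where
    f : ℕ → Carrier
    f k = pow y (q ^ℕ k)

  tr-frobenius^ : ∀ a y → tr (pow y (q ^ℕ a)) ≈ tr y
  tr-frobenius^ zero    y = tr-cong (*-identityʳ y)
  tr-frobenius^ (suc a) y = trans (tr-cong (pow-pow y q (q ^ℕ a))) (trans (tr-frobenius^ a (pow y q)) (tr-frobenius y))

  tr-scalar : ∀ y → Scalar (tr y)
  tr-scalar y = begin
    pow (tr y) (q ^ℕ 1)                              ≈⟨ pow-≡ (tr y) (ℕP.*-identityʳ q) ⟩
    pow (tr y) q                                     ≈⟨ frob-sum q-power (λ (i : Fin n) → pow y (q ^ℕ toℕ i)) ⟩
    sumF (λ (i : Fin n) → pow (pow y (q ^ℕ toℕ i)) q) ≈⟨ sumF-cong {n} (λ i → trans (sym (pow-pow y (q ^ℕ toℕ i) q))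
                                                          (trans (pow-≡ y (ℕP.*-comm (q ^ℕ toℕ i) q)) (pow-pow y q (q ^ℕ toℕ i)))) ⟩
    sumF (λ (i : Fin n) → pow (pow y q) (q ^ℕ toℕ i)) ≈⟨ tr-frobenius y ⟩
    tr y                                             ∎

  -- The trace is not identically zero: its kernel has at most q^(n-1) < N elements.
  tr-nonzero : ∃ λ w → ¬ (tr w ≈ 0#)
  tr-nonzero with FinP.any? (λ i → ¬? (tr (en i) ≟ 0#))
  ... | yes (i , tr≉0) = en i , tr≉0
  ... | no tr≡0 = ⊥-elim (ℕP.<⇒≱ (ℕP.^-monoʳ-< q 1<q (ℕP.n<1+n n'))
                    (ℕP.≤-trans (ℕP.≤-reflexive (P.trans q^n≡N (P.sym (count-all (λ i → tr (en i) ≟ 0#) all≈0))))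
                                (trace-kernel-bound q n' 1<q)))
    where
    all≈0 : ∀ i → tr (en i) ≈ 0#
    all≈0 i with tr (en i) ≟ 0#
    ... | yes tr≈0 = tr≈0
    ... | no tr≉0  = ⊥-elim (tr≡0 (i , tr≉0))

  -- Nondegeneracy: if Tr(y e'_l) = 0 for a spanning family e', then
  -- Tr(y z) = 0 for all z; as Tr(y · y⁻¹w) = Tr(w) ≠ 0 for y ≠ 0, y = 0.
  nondegenerate : (e' : Fin n → Carrier) → Spans q n e' → ∀ y → (∀ l → tr (y * e' l) ≈ 0#) → y ≈ 0#
  nondegenerate e' e'-spans y ⊥e' with y ≟ 0#
  ... | yes y≈0 = y≈0
  ... | no y≉0  = ⊥-elim (tr-w≉0 (trans (tr-cong (sym y·y⁻¹w≈w)) (⊥all (inv y y≉0 * w))))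
    where
    w = proj₁ tr-nonzero
    tr-w≉0 = proj₂ tr-nonzero
    y·y⁻¹w≈w : y * (inv y y≉0 * w) ≈ w
    y·y⁻¹w≈w = trans (sym (*-assoc _ _ _)) (trans (*-congʳ (inv-r y y≉0)) (*-identityˡ w))
    ⊥all : ∀ z → tr (y * z) ≈ 0#
    ⊥all z with e'-spans z (in-F_qⁿ z)
    ... | μ , μ∈Fq , z≈Σ = begin
      tr (y * z)                                 ≈⟨ tr-cong (trans (*-congˡ z≈Σ) (sumF-*ˡ {n} y (λ l → μ l * e' l))) ⟩
      tr (sumF (λ l → y * (μ l * e' l)))         ≈⟨ tr-sum {n} (λ l → y * (μ l * e' l)) ⟩
      sumF (λ l → tr (y * (μ l * e' l)))         ≈⟨ sumF-cong {n} (λ l → tr-cong (*-Props.x∙yz≈y∙xz y (μ l) (e' l))) ⟩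
      sumF (λ l → tr (μ l * (y * e' l)))         ≈⟨ sumF-cong {n} (λ l → tr-scalar* (μ∈Fq l) (y * e' l)) ⟩
      sumF (λ l → μ l * tr (y * e' l))           ≈⟨ sumF-zero {n} _ (λ l → trans (*-congˡ (⊥e' l)) (zeroʳ (μ l))) ⟩
      0#                                         ∎

  Orthogonal : ∀ d → (Fin d → Carrier) → Carrier → Set ℓ
  Orthogonal zero    w y = Lift ℓ ⊤
  Orthogonal (suc d) w y = tr (y * w fz) ≈ 0# × Orthogonal d (λ j → w (fs j)) y

  orthogonal-all : ∀ d w y → Orthogonal d w y → ∀ j → tr (y * w j) ≈ 0#
  orthogonal-all (suc d) w y (⊥w₀ , ⊥rest) fz     = ⊥w₀
  orthogonal-all (suc d) w y (⊥w₀ , ⊥rest) (fs j) = orthogonal-all d _ y ⊥rest j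

  orthogonal-subgroup : ∀ d w → Subgroup (Orthogonal d w)
  orthogonal-subgroup zero w = record
    { decSubset = record { dec = λ _ → yes (lift tt) ; resp = λ _ _ → lift tt }
    ; has-0 = lift tt ; +-closed = λ _ _ → lift tt ; neg-closed = λ _ → lift tt }
  orthogonal-subgroup (suc d) w = record
    { decSubset = record
      { dec  = λ y → (tr (y * w fz) ≟ 0#) ×-dec Subgroup.dec rest y
      ; resp = λ x≈y (⊥w₀ , ⊥rest) → trans (tr-cong (*-congʳ (sym x≈y))) ⊥w₀ , Subgroup.resp rest x≈y ⊥rest }
    ; has-0 = trans (tr-cong (zeroˡ _)) tr-0 , Subgroup.has-0 rest
    ; +-closed = λ (⊥x , ⊥x') (⊥y , ⊥y') →
        trans (tr-cong (distribʳ _ _ _)) (trans (tr-+ _ _) (trans (+-cong ⊥x ⊥y) (+-identityˡ 0#)))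
      , Subgroup.+-closed rest ⊥x' ⊥y'
    ; neg-closed = λ (⊥x , ⊥x') →
        trans (tr-cong (sym (-‿distribˡ-* _ _))) (trans (tr-neg _) (trans (-‿cong ⊥x) -‿0))
      , Subgroup.neg-closed rest ⊥x' }
    where rest = orthogonal-subgroup d (λ j → w (fs j))

  Orthogonal-set : ∀ d w → DecSubset (Orthogonal d w)
  Orthogonal-set d w = Subgroup.decSubset (orthogonal-subgroup d w)

  tr-against : ∀ a → Additive (λ y → tr (y * a))
  tr-against a = record { cong = λ x≈y → tr-cong (*-congʳ x≈y)
                        ; +-homo = λ x y → trans (tr-cong (distribʳ _ _ _)) (tr-+ _ _) }

  module Duality (Fq-size : ∣ Fixed (q ^ℕ 1) ∣ ≡ q) where

    -- Each orthogonality condition shrinks the complement by at most a factor q.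
    orthogonal-size : ∀ d w → N ≤ℕ q ^ℕ d *ℕ ∣ Orthogonal-set d w ∣
    orthogonal-size zero w = ℕP.≤-reflexive
      (P.trans (P.sym (count-all {d = N} (λ i → Subgroup.dec (orthogonal-subgroup 0 w) (en i)) (λ i → lift tt)))
               (P.sym (ℕP.+-identityʳ _)))
    orthogonal-size (suc d) w =
      ℕP.≤-trans (orthogonal-size d w')
        (ℕP.≤-trans (ℕP.*-monoʳ-≤ (q ^ℕ d) one-more)
                    (ℕP.≤-reflexive (P.trans (P.sym (ℕP.*-assoc (q ^ℕ d) q _)) (P.cong (_*ℕ ∣ Orthogonal-set (suc d) w ∣) (ℕP.*-comm (q ^ℕ d) q)))))
      where
      w' = λ j → w (fs j)
      open FibreBound (orthogonal-subgroup d w') (tr-against (w fz)) (Fixed (q ^ℕ 1)) (λ y _ → tr-scalar (y * w fz))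
      one-more : ∣ Orthogonal-set d w' ∣ ≤ℕ q *ℕ ∣ Orthogonal-set (suc d) w ∣
      one-more = ℕP.≤-trans fibre-bound
                   (ℕP.≤-reflexive (P.cong₂ _*ℕ_ Fq-size (count-ext {d = N} _ _ (λ i (r , z) → z , r) (λ i (z , r) → r , z))))

    nonzero-orthogonal : ∀ d w → d <ℕ n → ∃ λ y → Orthogonal d w y × ¬ (y ≈ 0#)
    nonzero-orthogonal d w d<n with count-witness nonzero? at-least-one
      where
      nonzero? : ∀ i → Dec (Orthogonal d w (en i) × ¬ (en i ≈ 0#))
      nonzero? i = Subgroup.dec (orthogonal-subgroup d w) (en i) ×-dec ¬? (en i ≟ 0#)
      q≤size : q ≤ℕ ∣ Orthogonal-set d w ∣
      q≤size = ℕP.*-cancelˡ-≤ (q ^ℕ d) {{ℕP.m^n≢0 q d {{ℕ.>-nonZero (ℕP.<-trans (s≤s z≤n) 1<q)}}}}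
                 (ℕP.≤-trans (ℕP.≤-reflexive (ℕP.*-comm (q ^ℕ d) q))
                   (ℕP.≤-trans (ℕP.^-monoʳ-≤ q {{ℕ.>-nonZero (ℕP.<-trans (s≤s z≤n) 1<q)}} d<n)
                     (ℕP.≤-trans (ℕP.≤-reflexive q^n≡N) (orthogonal-size d w))))
      zero-or-nonzero : ∀ i → Orthogonal d w (en i) → (Orthogonal d w (en i) × ¬ (en i ≈ 0#)) ⊎ en i ≈ 0#
      zero-or-nonzero i ⊥ with en i ≟ 0#
      ... | yes x≈0 = inj₂ x≈0
      ... | no x≉0  = inj₁ (⊥ , x≉0)
      -- |complement| ≥ q ≥ 2, and only one of its elements is 0
      at-least-one : 1 ≤ℕ count nonzero?
      at-least-one = ℕP.+-cancelʳ-≤ 1 1 (count nonzero?)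
        (ℕP.≤-trans 1<q (ℕP.≤-trans q≤size
          (ℕP.≤-trans (count-∪ nonzero? (λ i → en i ≟ 0#) (λ i → Subgroup.dec (orthogonal-subgroup d w) (en i)) zero-or-nonzero)
                      (ℕP.≤-reflexive (P.cong (count nonzero? +ℕ_) count-zero)))))
    ... | i , ⊥ , x≉0 = en i , ⊥ , x≉0

    module DualBasis (e' : Fin n → Carrier) (e'-spans : Spans q n e') where

      -- A nonzero y₀ orthogonal to all e'_k with k ≠ l has Tr(y₀ e'_l) ≠ 0
      -- by nondegeneracy; normalising it gives the l-th dual vector.
      module DualVector (l : Fin n) where
        private
          others : Fin n' → Carrier
          others j = e' (punchIn l j)

          witness = nonzero-orthogonal n' others (ℕP.n<1+n n')
          y₀ = proj₁ witness

          y₀⊥ : ∀ k → l ≢ k → tr (y₀ * e' k) ≈ 0#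
          y₀⊥ k l≢k = trans (tr-cong (*-congˡ (reflexive (P.cong e' (P.sym (FinP.punchIn-punchOut l≢k))))))
                            (orthogonal-all n' others y₀ (proj₁ (proj₂ witness)) (punchOut l≢k))

          c₀ : Carrier
          c₀ = tr (y₀ * e' l)

          c₀≉0 : ¬ (c₀ ≈ 0#)
          c₀≉0 c₀≈0 = proj₂ (proj₂ witness) (nondegenerate e' e'-spans y₀ ⊥all)
            where
            ⊥all : ∀ k → tr (y₀ * e' k) ≈ 0#
            ⊥all k with l FinP.≟ k
            ... | yes P.refl = c₀≈0
            ... | no l≢k     = y₀⊥ k l≢k

          c₀⁻¹∈Fq : Scalar (inv c₀ c₀≉0)
          c₀⁻¹∈Fq = scalar-inv c₀≉0 (tr-scalar _)

        u : Carrier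
        u = inv c₀ c₀≉0 * y₀

        u-diagonal : tr (u * e' l) ≈ 1#
        u-diagonal = trans (tr-cong (*-assoc _ _ _)) (trans (tr-scalar* c₀⁻¹∈Fq _) (inv-l c₀ c₀≉0))

        u-off-diagonal : ∀ k → l ≢ k → tr (u * e' k) ≈ 0#
        u-off-diagonal k l≢k = trans (tr-cong (*-assoc _ _ _))
                                 (trans (tr-scalar* c₀⁻¹∈Fq _) (trans (*-congˡ (y₀⊥ k l≢k)) (zeroʳ _)))

      dual : Fin n → Carrier
      dual = DualVector.u

      coordinate : ∀ (μ : Fin n → Carrier) → (∀ l → Scalar (μ l)) → ∀ k → tr (sumF (λ l → μ l * dual l) * e' k) ≈ μ k
      coordinate μ μ∈Fq k = begin
        tr (sumF (λ l → μ l * dual l) * e' k)   ≈⟨ tr-cong (sumF-*ʳ {n} (e' k) (λ l → μ l * dual l)) ⟩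
        tr (sumF (λ l → μ l * dual l * e' k))   ≈⟨ tr-sum {n} (λ l → μ l * dual l * e' k) ⟩
        sumF (λ l → tr (μ l * dual l * e' k))   ≈⟨ sumF-cong {n} (λ l → trans (tr-cong (*-assoc (μ l) (dual l) (e' k)))
                                                                             (tr-scalar* (μ∈Fq l) (dual l * e' k))) ⟩
        sumF (λ l → μ l * tr (dual l * e' k))   ≈⟨ sumF-single {n} (λ l → μ l * tr (dual l * e' k)) k
                                                     (λ l l≢k → trans (*-congˡ (DualVector.u-off-diagonal l k l≢k)) (zeroʳ _)) ⟩
        μ k * tr (dual k * e' k)                ≈⟨ *-congˡ (DualVector.u-diagonal k) ⟩
        μ k * 1#                                ≈⟨ *-identityʳ _ ⟩
        μ k                                     ∎

      -- Every y is Σ_l Tr(y e'_l) u_l: the difference is orthogonal to all e'_k.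
      expansion : ∀ y → y ≈ sumF (λ l → tr (y * e' l) * dual l)
      expansion y = x-y≈0⇒x≈y (nondegenerate e' e'-spans (y - S) ⊥e')
        where
        S = sumF (λ l → tr (y * e' l) * dual l)
        ⊥e' : ∀ k → tr ((y - S) * e' k) ≈ 0#
        ⊥e' k = begin
          tr ((y - S) * e' k)             ≈⟨ tr-cong (trans (distribʳ (e' k) y (- S)) (+-congˡ (sym (-‿distribˡ-* S (e' k))))) ⟩
          tr (y * e' k - S * e' k)        ≈⟨ trans (tr-+ _ _) (+-congˡ (tr-neg _)) ⟩
          tr (y * e' k) - tr (S * e' k)   ≈⟨ +-congˡ (-‿cong (coordinate (λ l → tr (y * e' l)) (λ l → tr-scalar _) k)) ⟩
          tr (y * e' k) - tr (y * e' k)   ≈⟨ -‿inverseʳ _ ⟩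
          0#                              ∎

      dual-basis : IsBasis q n dual
      dual-basis = (λ l → in-F_qⁿ _) , independent , (λ x _ → (λ l → tr (x * e' l)) , (λ l → tr-scalar _) , expansion x)
        where
        independent : LinIndep q dual
        independent μ μ∈Fq Σ≈0 k = trans (sym (coordinate μ μ∈Fq k)) (trans (tr-cong (trans (*-congʳ Σ≈0) (zeroˡ _))) tr-0)

-- With j = k(n - 1) we
-- have k s + j s ≡ 0 (mod n), so applying the Frobenius x ↦ x^(q^(js))
-- inside the trace turns f^(k)_{a,s}(x, x') = Tr(a x x'^(q^(ks))) into
-- Tr(a^(q^(js)) x^(q^(js)) x').  Hence the form Σ_s f^(k)_{a_s,s} has matrix
-- entries Tr(F(e_i) e'_l) for the linearized polynomial
-- F = Σ_s a_s^(q^(js)) x^(q^(js)), and Tr(F(e_i) e'_l) is the l-th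
-- coordinate of F(e_i) in the trace-dual basis of e'.
module Gabidulin {c ℓ} (R : CommutativeRing c ℓ) (isField : FF.IsField R)
                 (q n' : ℕ) (card : FF.HasCard R (q ^ℕ suc n'))
                 (p r : ℕ) (p-prime : Prime p) (1≤r : 1 ≤ℕ r) (q≡p^r : q ≡ p ^ℕ r)
                 (m k t : ℕ) (1≤m : 1 ≤ℕ m) (m∣n : m ∣ suc n') where
  open Counting
  open Arithmetic
  open import Data.Nat.Tactic.RingSolver using (solve-∀)

  private
    N≡p^[rn] : q ^ℕ suc n' ≡ p ^ℕ (r *ℕ suc n')
    N≡p^[rn] = P.trans (P.cong (_^ℕ suc n') q≡p^r) (ℕP.^-*-assoc p r (suc n'))

    q-power : IsPowerOf p q
    q-power = r , q≡p^r

    1<q : 1 <ℕ q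
    1<q = P.subst (1 <ℕ_) (P.sym q≡p^r)
            (ℕP.^-monoʳ-< p (prime≥2 p-prime) {0} {r} 1≤r)

    1<q^ : ∀ s → 1 ≤ℕ s → 1 <ℕ q ^ℕ s
    1<q^ s 1≤s = ℕP.^-monoʳ-< q 1<q {0} {s} 1≤s

  open Trace R isField (q ^ℕ suc n') card p p-prime (r *ℕ suc n') N≡p^[rn] q q-power 1<q n' P.refl public

  subfield-size : ∀ s → 1 ≤ℕ s → s ∣ n → ∣ Fixed (q ^ℕ s) ∣ ≡ q ^ℕ s
  subfield-size s 1≤s (divides (suc d) n≡[d+1]s) =
    SubfieldSize.fixed-count (q ^ℕ s) d (powerOf-^ q-power s) (1<q^ s 1≤s)
      (P.trans (ℕP.^-*-assoc q s (suc d)) (P.cong (q ^ℕ_) (P.trans (ℕP.*-comm s (suc d)) (P.sym n≡[d+1]s))))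

  Fq-size : ∣ Fixed (q ^ℕ 1) ∣ ≡ q
  Fq-size = P.trans (subfield-size 1 ℕP.≤-refl (divides n (P.sym (ℕP.*-identityʳ n)))) (ℕP.*-identityʳ q)

  open Dimension Fq-size

  e-basis : Σ (Fin m → Carrier) (IsBasis q m)
  e-basis = BasisOf.basis m (subfield-size m 1≤m m∣n)

  e : Fin m → Carrier
  e = proj₁ e-basis

  e'-basis : Σ (Fin n → Carrier) (IsBasis q n)
  e'-basis = BasisOf.basis n (subfield-size n (s≤s z≤n) (divides 1 (P.sym (ℕP.*-identityˡ n))))

  e' : Fin n → Carrier
  e' = proj₁ e'-basis

  open Duality Fq-size
  open DualBasis e' (proj₂ (proj₂ (proj₂ e'-basis))) public

  -- The exponent of the Gabidulin code: j = k(n - 1) ≡ -k (mod n).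
  j : ℕ
  j = k *ℕ n'

  private
    ks+js≡n[ks] : ∀ k n' s → k *ℕ s +ℕ k *ℕ n' *ℕ s ≡ suc n' *ℕ (k *ℕ s)
    ks+js≡n[ks] = solve-∀

  tr-twist : ∀ a x x' A B w → B +ℕ A ≡ n *ℕ w →
             tr (a * x * pow x' (q ^ℕ B)) ≈ tr (pow a (q ^ℕ A) * pow x (q ^ℕ A) * x')
  tr-twist a x x' A B w B+A≡nw = begin
    tr (a * x * pow x' (q ^ℕ B))                    ≈⟨ sym (tr-frobenius^ A _) ⟩
    tr (pow (a * x * pow x' (q ^ℕ B)) Q)            ≈⟨ tr-cong (trans (pow-* (a * x) (pow x' (q ^ℕ B)) Q) (*-congʳ (pow-* a x Q))) ⟩
    tr (pow a Q * pow x Q * pow (pow x' (q ^ℕ B)) Q) ≈⟨ tr-cong (*-congˡ x'-returns) ⟩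
    tr (pow a Q * pow x Q * x')                     ∎
    where
    Q = q ^ℕ A
    x'-returns : pow (pow x' (q ^ℕ B)) Q ≈ x'
    x'-returns = begin
      pow (pow x' (q ^ℕ B)) Q      ≈⟨ sym (pow-pow x' (q ^ℕ B) Q) ⟩
      pow x' (q ^ℕ B *ℕ q ^ℕ A)    ≈⟨ pow-≡ x' (P.trans (P.sym (ℕP.^-distribˡ-+-* q B A)) (P.cong (q ^ℕ_) B+A≡nw)) ⟩
      pow x' (q ^ℕ (n *ℕ w))       ≈⟨ pow-q^[nw] w x' ⟩
      x'                           ∎

  tr-linPoly : ∀ (cs : Fin t → Carrier) x x' →
               tr (LinPoly q j cs x * x') ≈ sumF (λ s → tr (cs s * pow x (q ^ℕ (j *ℕ toℕ s)) * x'))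
  tr-linPoly cs x x' = trans (tr-cong (sumF-*ʳ {t} x' (λ s → cs s * pow x (q ^ℕ (j *ℕ toℕ s)))))
                             (tr-sum {t} (λ s → cs s * pow x (q ^ℕ (j *ℕ toℕ s)) * x'))

  form≈tr-linPoly : ∀ (a : Fin t → Carrier) x x' →
    sumF (λ (s : Fin t) → fForm q n k (a s) (toℕ s) x x')
      ≈ tr (LinPoly q j (λ s → pow (a s) (q ^ℕ (j *ℕ toℕ s))) x * x')
  form≈tr-linPoly a x x' = begin
    sumF (λ s → fForm q n k (a s) (toℕ s) x x')
      ≈⟨ sumF-cong {t} (λ s → tr-twist (a s) x x' (j *ℕ toℕ s) (k *ℕ toℕ s) (k *ℕ toℕ s) (ks+js≡n[ks] k n' (toℕ s))) ⟩
    sumF (λ s → tr (pow (a s) (q ^ℕ (j *ℕ toℕ s)) * pow x (q ^ℕ (j *ℕ toℕ s)) * x'))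
      ≈⟨ sym (tr-linPoly _ x x') ⟩
    tr (LinPoly q j (λ s → pow (a s) (q ^ℕ (j *ℕ toℕ s))) x * x') ∎

  PhiMatrix : Matrix m n → Set (c ⊔ ℓ)
  PhiMatrix M = ∃ λ f → FF.Phi R q m n k t f × (∀ i l → M i l ≈ f (e i) (e' l))

  private
    e∈F_qᵐ : ∀ i → InSub q m (e i)
    e∈F_qᵐ = proj₁ (proj₂ e-basis)

    untwist : ∀ c s → pow (pow c (q ^ℕ (k *ℕ s))) (q ^ℕ (j *ℕ s)) ≈ c
    untwist c s = begin
      pow (pow c (q ^ℕ (k *ℕ s))) (q ^ℕ (j *ℕ s))   ≈⟨ sym (pow-pow c (q ^ℕ (k *ℕ s)) (q ^ℕ (j *ℕ s))) ⟩
      pow c (q ^ℕ (k *ℕ s) *ℕ q ^ℕ (j *ℕ s))        ≈⟨ pow-≡ c (P.trans (P.sym (ℕP.^-distribˡ-+-* q (k *ℕ s) (j *ℕ s)))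
                                                                        (P.cong (q ^ℕ_) (ks+js≡n[ks] k n' s))) ⟩
      pow c (q ^ℕ (n *ℕ (k *ℕ s)))                  ≈⟨ pow-q^[nw] (k *ℕ s) c ⟩
      c                                             ∎

  Phi⇒Gabidulin : ∀ M → PhiMatrix M → InGabidulin q m n t j e dual M
  Phi⇒Gabidulin M (f , (a , f≈Σ) , M≈f) = cs , row
    where
    cs : Fin t → Carrier
    cs s = pow (a s) (q ^ℕ (j *ℕ toℕ s))
    entry : ∀ i l → tr (LinPoly q j cs (e i) * e' l) ≈ M i l
    entry i l = begin
      tr (LinPoly q j cs (e i) * e' l)                        ≈⟨ sym (form≈tr-linPoly a (e i) (e' l)) ⟩
      sumF (λ s → fForm q n k (a s) (toℕ s) (e i) (e' l))     ≈⟨ sym (f≈Σ (e i) (e' l) (e∈F_qᵐ i)) ⟩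
      f (e i) (e' l)                                          ≈⟨ sym (M≈f i l) ⟩
      M i l                                                   ∎
    row : ∀ i → LinPoly q j cs (e i) ≈ sumF (λ l → M i l * dual l)
    row i = trans (expansion (LinPoly q j cs (e i))) (sumF-cong {n} (λ l → *-congʳ {dual l} (entry i l)))

  Gabidulin⇒Phi : ∀ M → (∀ i l → Scalar (M i l)) → InGabidulin q m n t j e dual M → PhiMatrix M
  Gabidulin⇒Phi M M∈Fq (cs , row) = f , (a , λ x x' _ → refl) , M≈f
    where
    a : Fin t → Carrier
    a s = pow (cs s) (q ^ℕ (k *ℕ toℕ s))
    f : Form
    f x x' = sumF (λ (s : Fin t) → fForm q n k (a s) (toℕ s) x x')
    M≈f : ∀ i l → M i l ≈ f (e i) (e' l)
    M≈f i l = sym (begin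
      f (e i) (e' l)                                          ≈⟨ form≈tr-linPoly a (e i) (e' l) ⟩
      tr (LinPoly q j (λ s → pow (a s) (q ^ℕ (j *ℕ toℕ s))) (e i) * e' l)
        ≈⟨ tr-cong (*-congʳ (sumF-cong {t} (λ s → *-congʳ (untwist (cs s) (toℕ s))))) ⟩
      tr (LinPoly q j cs (e i) * e' l)                        ≈⟨ tr-cong (*-congʳ (row i)) ⟩
      tr (sumF (λ l' → M i l' * dual l') * e' l)              ≈⟨ coordinate (M i) (M∈Fq i) l ⟩
      M i l                                                   ∎)

open Arithmetic using (coprime-*pred)
open import Data.Nat using (_+_; _∸_; _^_; _≤_; _<_)
open import Data.Nat.GCD using (gcd)
open import Function.Bundles using (mk⇔)
open import Relation.Binary.PropositionalEquality using (refl)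

-- For n = 0 there is no field with q^0 = 1 element.
theorem3p10 : ∀ {c ℓ} (R : CommutativeRing c ℓ) (q m n k t : ℕ) →
    IsPrimePower q →
    FF.IsField R → FF.HasCard R (q ^ n) →
    1 < m → m ∣ n →
    1 ≤ k → gcd k n ≡ 1 →
    1 ≤ t → t ≤ m →
    FF.IsGenGabidulinForms R q m n (m ∸ t + 1) (FF.Phi R q m n k t)
theorem3p10 R q m zero k t _ isField card _ _ _ _ _ _ = ⊥-elim (FiniteField.N≢1 R isField (q ^ 0) card refl)
theorem3p10 R q m (suc n') k t (p , r , p-prime , 1≤r , q≡p^r) isField card 1<m m∣n _ gcd[k,n]≡1 1≤t t≤m =
    e , proj₂ e-basis , e' , proj₂ e'-basis
  , t , 1≤t , t≤m , refl
  , e , proj₁ (proj₂ (proj₂ e-basis))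
  , j , coprime-*pred k (suc n') (s≤s z≤n) gcd[k,n]≡1
  , dual , dual-basis
  , λ M M∈Fq → mk⇔ (Phi⇒Gabidulin M) (Gabidulin⇒Phi M M∈Fq)
  where open Gabidulin R isField q n' card p r p-prime 1≤r q≡p^r m k t (ℕP.<⇒≤ 1<m) m∣n
          using (e; e-basis; e'; e'-basis; j; dual; dual-basis; Phi⇒Gabidulin; Gabidulin⇒Phi)
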